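{- Let $\Delta$ be a simplicial complex. Assume $\mathcal{E}_d(\Delta,\mathbf{k}) \neq \emptyset$ and let $F \in \mathcal{E}_d(\Delta,\mathbf{k})$. Then $\Delta=\langle G \in \mathcal{F}(\Delta):G \neq F\rangle \cup \langle F\rangle$ is a homology splitting of $\Delta$ over $\mathbf{k}$.
   Context: $\mathbf{k}$ is a field, $\mathcal{F}(\Delta)$ is the set of facets of $\Delta$ and $\langle\cdot\rangle$ denotes the simplicial complex generated by the given facets. A $d$-dimensional facet of $\Delta$ is essential with respect to $\mathbf{k}$ if it belongs to a $d$-cycle of $\Delta$ over $\mathbf{k}$; $\mathcal{E}_d(\Delta,\mathbf{k})$ is the set of such facets. A decomposition $\Delta=\Delta_1\cup\Delta_2$ obtained by partitioning the facets (standard decomposition) is a homology splitting over $\mathbf{k}$ if $\Delta_1\cap\Delta_2=\emptyset$ or if $\widetilde{\beta}_k(\Delta;\mathbf{k})=\widetilde{\beta}_k(\Delta_1;\mathbf{k})+\widetilde{\beta}_k(\Delta_2;\mathbf{k})+\widetilde{\beta}_{k-1}(\Delta_1\cap\Delta_2;\mathbf{k})$ for every $k\in\mathbb{N}$, $\widetilde{\beta}_k$ being the dimension of reduced homology. -}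

module Defs where

open import Level using (Level; _⊔_)
open import Algebra.Bundles using (CommutativeRing)
open import Data.Nat as ℕ using (ℕ; zero; suc)
open import Data.Fin using (Fin; zero; suc)
open import Data.Product using (Σ; _×_; _,_; ∃)
open import Data.List using (List; []; _∷_; map; length; filter; deduplicate; concatMap; lookup; _++_)
open import Data.List.Properties using (≡-dec)
open import Data.List.Membership.DecPropositional (≡-dec ℕ._≟_) using (_∈?_)
open import Data.List.Relation.Unary.Linked using (Linked)
open import Data.List.Relation.Unary.AllPairs using (AllPairs)
open import Data.List.Relation.Binary.Subset.Propositional using (_⊆_)
open import Data.List.Membership.Propositional using (_∈_)
open import Relation.Binary.PropositionalEquality using (_≡_)
open import Relation.Nullary using (¬_; yes; no)
open import Function.Definitions using (Injective)

record Field (c ℓ : Level) : Set (Level.suc (c ⊔ ℓ)) where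
  field
    commutativeRing : CommutativeRing c ℓ
  open CommutativeRing commutativeRing public
  field
    0≉1     : ¬ (0# ≈ 1#)
    inverse : ∀ x → ¬ (x ≈ 0#) → Σ Carrier (λ y → x * y ≈ 1#)

-- Combinatorics of simplicial complexes.
-- Vertices are natural numbers; a face is a strictly increasing list of
-- vertices (the empty list is the empty face).

Face : Set
Face = List ℕ

IsFace : Face → Set
IsFace σ = Linked ℕ._<_ σ

subfaces : Face → List Face
subfaces []      = [] ∷ []
subfaces (v ∷ σ) = subfaces σ ++ map (v ∷_) (subfaces σ)

-- A finite simplicial complex, given by the list of ALL its faces
-- (without repetitions).
Complex : Set
Complex = List Face

-- ⟨ L ⟩ : the simplicial complex generated by the faces in L
-- (all subsets of members of L, without repetition).  ⟨ [] ⟩ is the void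
-- complex (no faces at all).
⟨_⟩ : List Face → Complex
⟨ L ⟩ = deduplicate (≡-dec ℕ._≟_) (concatMap subfaces L)

_∩_ : Complex → Complex → Complex
Δ₁ ∩ Δ₂ = filter (_∈? Δ₂) Δ₁

-- the faces with exactly j vertices (i.e. of dimension j - 1)
faces : ℕ → Complex → List Face
faces j Δ = filter (λ σ → length σ ℕ.≟ j) Δ

IsFacetList : List Face → Set
IsFacetList L = Data.List.Relation.Unary.All.All IsFace L × AllPairs (λ G H → ¬ (G ⊆ H) × ¬ (H ⊆ G)) L
  where import Data.List.Relation.Unary.All

-- Δ₁ ∩ Δ₂ = ∅ : the intersection has no vertex
NoVertex : Complex → Set
NoVertex Δ = ∀ σ → σ ∈ Δ → σ ≡ []

-- boundary of a face: the codimension-one faces, each with the index of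
-- the removed vertex
bd : Face → List (ℕ × Face)
bd []      = []
bd (v ∷ σ) = (0 , σ) ∷ map (λ { (i , τ) → (suc i , v ∷ τ) }) (bd σ)

module Homology {c ℓ} (K : Field c ℓ) where
  open Field K using (Carrier; _≈_; _+_; _*_; -_; 0#; 1#)

  sumF : ∀ {m} → (Fin m → Carrier) → Carrier
  sumF {zero}  f = 0#
  sumF {suc m} f = f zero + sumF (λ i → f (suc i))

  Family : ℕ → ℕ → Set c
  Family m n = Fin m → Fin n → Carrier

  LinIndependent : ∀ {m n} → Family m n → Set (c ⊔ ℓ)
  LinIndependent {m} v = ∀ (a : Fin m → Carrier) →
    (∀ t → sumF (λ i → a i * v i t) ≈ 0#) → ∀ i → a i ≈ 0#

  HasRank : ∀ {m n} → Family m n → ℕ → Set (c ⊔ ℓ)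
  HasRank {m} v r =
    Σ (Fin r → Fin m) (λ s → Injective _≡_ _≡_ s × LinIndependent (λ i → v (s i)))
    × (∀ (s : Fin (suc r) → Fin m) → Injective _≡_ _≡_ s → ¬ LinIndependent (λ i → v (s i)))

  sgn : ℕ → Carrier
  sgn zero    = 1#
  sgn (suc i) = - sgn i

  coef : Face → Face → Carrier
  coef σ τ = go (bd σ)
    where
    go : List (ℕ × Face) → Carrier
    go [] = 0#
    go ((i , ρ) ∷ xs) with ≡-dec ℕ._≟_ τ ρ
    ... | yes _ = sgn i + go xs
    ... | no  _ = go xs

  bdFamily : (S T : List Face) → Family (length S) (length T)
  bdFamily S T i t = coef (lookup S i) (lookup T t)

  -- the j-th boundary map ∂ : C_{j-1} → C_{j-2} in "number of vertices"
  -- indexing: chains on faces with j vertices; faces with 0 vertices (the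
  -- empty face) form degree -1 (augmented / reduced chain complex), and
  -- the map out of degree -1 is zero.
  lowerFaces : Complex → ℕ → List Face
  lowerFaces Δ zero    = []
  lowerFaces Δ (suc j) = faces j Δ

  ∂ : (Δ : Complex) (j : ℕ) → Family (length (faces j Δ)) (length (lowerFaces Δ j))
  ∂ Δ j = bdFamily (faces j Δ) (lowerFaces Δ j)

  -- b = β̃_{j-1}(Δ ; K) : b = f_{j-1} - rank ∂_{j-1} - rank ∂_j
  RBetti : Complex → ℕ → ℕ → Set (c ⊔ ℓ)
  RBetti Δ j b = Σ ℕ λ r₁ → Σ ℕ λ r₂ →
    HasRank (∂ Δ j) r₁ × HasRank (∂ Δ (suc j)) r₂ × (b ℕ.+ r₁ ℕ.+ r₂ ≡ length (faces j Δ))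

  β̃ : Complex → ℕ → ℕ → Set (c ⊔ ℓ)
  β̃ Δ k b = RBetti Δ (suc k) b

  β̃₋₁ : Complex → ℕ → Set (c ⊔ ℓ)
  β̃₋₁ Δ b = RBetti Δ zero b

  -- F ∈ 𝓔_d(⟨L⟩, K), where L is the facet list of the complex:
  -- F is a d-dimensional facet lying in the support of a (reduced) d-cycle.
  Essential : List Face → ℕ → Face → Set (c ⊔ ℓ)
  Essential L d F =
    F ∈ L × length F ≡ suc d ×
    Σ (Fin (length (faces (suc d) ⟨ L ⟩))) λ i →
      lookup (faces (suc d) ⟨ L ⟩) i ≡ F ×
      Σ (Fin (length (faces (suc d) ⟨ L ⟩)) → Carrier) λ z →
        (∀ t → sumF (λ s → z s * ∂ ⟨ L ⟩ (suc d) s t) ≈ 0#) × ¬ (z i ≈ 0#)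

  HomologySplitting : Complex → Complex → Complex → Set (c ⊔ ℓ)
  HomologySplitting Δ Δ₁ Δ₂ =
    NoVertex (Δ₁ ∩ Δ₂) ⊎
    (∀ (k b b₁ b₂ b₃ : ℕ) → β̃ Δ k b → β̃ Δ₁ k b₁ → β̃ Δ₂ k b₂ →
       RBetti (Δ₁ ∩ Δ₂) k b₃ → b ≡ b₁ ℕ.+ b₂ ℕ.+ b₃)
    where open import Data.Sum using (_⊎_)

otherFacets : Face → List Face → List Face
otherFacets F L = filter (λ G → Relation.Nullary.¬? (≡-dec ℕ._≟_ G F)) L
  where import Relation.Nullary

{-# OPTIONS --safe #-}
module Submission where

-- Let z be a d-cycle of Δ = ⟨L⟩ with nonzero coefficient at F. A boundary face of F lying in
-- no other facet would occur in ∂z with coefficient ±z_F, so every proper face of F lies in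
-- Δ₁; hence Δ₁ ∩ ⟨F⟩ is the boundary of the simplex F, and Δ has exactly one face more than
-- Δ₁, namely F. Since z also expresses the row of F in the boundary matrix through the other
-- rows, Δ and Δ₁ have the same boundary ranks, so β̃_k(Δ) = β̃_k(Δ₁) + [k = d]. Writing the
-- simplex F = v₀ ∷ F′ as the cone with apex v₀ over F′, the rows of the cone faces v₀ ∷ τ form a
-- basis of the row space of each boundary matrix of ⟨F⟩ and of its boundary, which gives
-- β̃_k(⟨F⟩) = 0 and β̃_{k-1}(∂F) = [k = d]. Ranks are compared constructively, by Steinitz
-- exchange and by Gaussian elimination under double negation; this suffices because the
-- conclusions are (in)equalities between natural numbers.

open import Defs
open import Level using (Level)
open import Data.Nat using (ℕ)
open import Data.List using (List; []; _∷_)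

open import Level using (_⊔_)
open import Data.Bool using (true; false; if_then_else_)
open import Data.Empty using (⊥; ⊥-elim)
open import Data.Nat as ℕ using (zero; suc; _<_; _≤_)
import Data.Nat.Properties as ℕ
open import Data.Fin as Fin using (Fin; zero; suc; punchIn; inject≤)
import Data.Fin.Properties as Fin
open import Data.Vec.Functional using (insertAt)
open import Data.Vec.Functional.Properties using (insertAt-lookup; insertAt-punchIn)
open import Data.List using (map; length; lookup; _++_; concatMap)
open import Data.List.Properties using (≡-dec; ∷-injective; length-++; length-map)
open import Data.List.Membership.Propositional using (_∈_; _∉_; find; lose)
open import Data.List.Membership.Propositional.Properties
  using (∈-lookup; ∈-++⁺ˡ; ∈-++⁺ʳ; ∈-++⁻; ∈-map⁺; ∈-map⁻; ∈-concatMap⁺; ∈-concatMap⁻;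
         ∈-deduplicate⁺; ∈-deduplicate⁻; ∈-filter⁺; ∈-filter⁻)
open import Data.List.Membership.DecPropositional (≡-dec ℕ._≟_) using (_∈?_)
open import Data.List.Relation.Unary.Any using (here; there; index)
open import Data.List.Relation.Unary.Any.Properties using (lookup-index)
open import Data.List.Relation.Unary.All as All using (All; []; _∷_)
import Data.List.Relation.Unary.All.Properties as All
open import Data.List.Relation.Unary.AllPairs as AllPairs using (AllPairs; []; _∷_)
import Data.List.Relation.Unary.AllPairs.Properties as AllPairs
open import Data.List.Relation.Unary.Linked using ([]; [-]; _∷_)
open import Data.List.Relation.Unary.Unique.Propositional using (Unique)
import Data.List.Relation.Unary.Unique.Propositional.Properties as Unique
open import Data.List.Relation.Unary.Unique.DecPropositional.Properties (≡-dec ℕ._≟_) using (deduplicate-!)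
open import Data.List.Relation.Binary.Subset.Propositional using (_⊆_)
open import Data.List.Relation.Binary.Sublist.Propositional using ([]; _∷_; _∷ʳ_; ⊆-refl; ⊆-trans)
  renaming (_⊆_ to _⊑_)
open import Data.List.Relation.Binary.Sublist.Propositional.Properties using (to-≋; Any-resp-⊆)
open import Data.List.Relation.Binary.Equality.Propositional using (≋⇒≡)
open import Data.Product using (Σ; ∃; ∃₂; _×_; _,_; proj₁; proj₂)
open import Data.Sum using (_⊎_; inj₁; inj₂)
open import Function using (_∘_)
open import Function.Definitions using (Injective)
open import Relation.Binary.PropositionalEquality as ≡ using (_≡_; _≢_)
open import Relation.Nullary using (¬_; ¬?; Dec; does; yes; no; contradiction)
open import Relation.Nullary.Decidable using (¬¬-excluded-middle)

¬¬-Π-Fin : ∀ {p m} {A : Fin m → Set p} → (∀ i → ¬ ¬ A i) → ¬ ¬ (∀ i → A i)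
¬¬-Π-Fin {m = zero}  _   ¬all = ¬all (λ ())
¬¬-Π-Fin {m = suc m} ¬¬A ¬all = ¬¬A zero λ A₀ →
  ¬¬-Π-Fin (¬¬A ∘ suc) λ A₊ → ¬all λ { zero → A₀ ; (suc i) → A₊ i }

module LinearAlgebra {c ℓ} (K : Field c ℓ) where

  open Field K hiding (zero)
  open Homology K using (sumF; LinIndependent; HasRank)
  open import Algebra.Properties.Ring ring
    using (-‿distribˡ-*; -‿distribʳ-*; -0#≈0#; -‿+-comm; +-inverseˡ-unique; x∙y⁻¹≈ε⇒x≈y; x[y-z]≈xy-xz; [y-z]x≈yx-zx)
  open import Algebra.Properties.Semiring.Sum semiring
    using (sum; sum-cong-≋; sum-remove; ∑-distrib-+; ∑-comm; *-distribˡ-sum; *-distribʳ-sum; sum-replicate-zero)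
  import Algebra.Properties.CommutativeSemigroup *-commutativeSemigroup as *-CS
  import Algebra.Properties.CommutativeSemigroup +-commutativeSemigroup as +-CS
  open import Relation.Binary.Reasoning.Setoid setoid

  _⁻¹⟨_⟩ : (x : Carrier) → ¬ (x ≈ 0#) → Carrier
  x ⁻¹⟨ x≉0 ⟩ = proj₁ (inverse x x≉0)

  ⁻¹-inverseˡ : ∀ x (x≉0 : ¬ (x ≈ 0#)) → x ⁻¹⟨ x≉0 ⟩ * x ≈ 1#
  ⁻¹-inverseˡ x x≉0 = trans (*-comm _ x) (proj₂ (inverse x x≉0))

  ⁻¹-cancelˡ : ∀ x (x≉0 : ¬ (x ≈ 0#)) y → x ⁻¹⟨ x≉0 ⟩ * (x * y) ≈ y
  ⁻¹-cancelˡ x x≉0 y = begin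
    x ⁻¹⟨ x≉0 ⟩ * (x * y)   ≈⟨ *-assoc _ x y ⟨
    x ⁻¹⟨ x≉0 ⟩ * x * y     ≈⟨ *-congʳ (⁻¹-inverseˡ x x≉0) ⟩
    1# * y                  ≈⟨ *-identityˡ y ⟩
    y                       ∎

  nonzero-cancel : ∀ {x y} → ¬ (x ≈ 0#) → x * y ≈ 0# → y ≈ 0#
  nonzero-cancel {x} {y} x≉0 xy≈0 = begin
    y                       ≈⟨ ⁻¹-cancelˡ x x≉0 y ⟨
    x ⁻¹⟨ x≉0 ⟩ * (x * y)   ≈⟨ *-congˡ xy≈0 ⟩
    x ⁻¹⟨ x≉0 ⟩ * 0#        ≈⟨ zeroʳ _ ⟩
    0#                      ∎

  [x+y]-[x+z]≈y-z : ∀ x y z → (x + y) - (x + z) ≈ y - z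
  [x+y]-[x+z]≈y-z x y z = begin
    (x + y) - (x + z)       ≈⟨ +-congˡ (-‿+-comm x z) ⟨
    (x + y) + (- x + - z)   ≈⟨ +-CS.interchange x y (- x) (- z) ⟩
    (x - x) + (y - z)       ≈⟨ +-congʳ (-‿inverseʳ x) ⟩
    0# + (y - z)            ≈⟨ +-identityˡ _ ⟩
    y - z                   ∎

  sumF≡sum : ∀ {m} (f : Fin m → Carrier) → sumF f ≡ sum f
  sumF≡sum {zero}  f = ≡.refl
  sumF≡sum {suc m} f = ≡.cong (f zero +_) (sumF≡sum (f ∘ suc))

  sum-zero : ∀ {m} {f : Fin m → Carrier} → (∀ i → f i ≈ 0#) → sum f ≈ 0#
  sum-zero {m} f≈0 = trans (sum-cong-≋ f≈0) (sum-replicate-zero m)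

  sum-neg : ∀ {m} (f : Fin m → Carrier) → sum (λ i → - f i) ≈ - sum f
  sum-neg {zero}  f = sym -0#≈0#
  sum-neg {suc m} f = trans (+-congˡ (sum-neg (f ∘ suc))) (-‿+-comm (f zero) _)

  sum-sub : ∀ {m} (f g : Fin m → Carrier) → sum (λ i → f i - g i) ≈ sum f - sum g
  sum-sub f g = trans (∑-distrib-+ f (λ i → - g i)) (+-congˡ (sum-neg g))

  sum-single : ∀ {m} {f : Fin m → Carrier} k → (∀ i → i ≢ k → f i ≈ 0#) → sum f ≈ f k
  sum-single {suc m} {f} k f≈0 = begin
    sum f                               ≈⟨ sum-remove {i = k} f ⟩
    f k + sum (λ j → f (punchIn k j))   ≈⟨ +-congˡ (sum-zero (λ j → f≈0 _ (Fin.punchInᵢ≢i k j))) ⟩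
    f k + 0#                            ≈⟨ +-identityʳ (f k) ⟩
    f k                                 ∎

  infix 8 _·_

  _·_ : ∀ {m} → (Fin m → Carrier) → (Fin m → Carrier) → Carrier
  a · x = sum (λ i → a i * x i)

  ·-congˡ : ∀ {m} {a b : Fin m → Carrier} x → (∀ i → a i ≈ b i) → a · x ≈ b · x
  ·-congˡ x a≈b = sum-cong-≋ (λ i → *-congʳ (a≈b i))

  ·-congʳ : ∀ {m} a {x y : Fin m → Carrier} → (∀ i → x i ≈ y i) → a · x ≈ a · y
  ·-congʳ a x≈y = sum-cong-≋ (λ i → *-congˡ (x≈y i))

  ·-comm : ∀ {m} (a x : Fin m → Carrier) → a · x ≈ x · a
  ·-comm a x = sum-cong-≋ (λ i → *-comm (a i) (x i))

  ·-scaleˡ : ∀ {m} β (a x : Fin m → Carrier) → (λ i → β * a i) · x ≈ β * (a · x)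
  ·-scaleˡ β a x = trans (sum-cong-≋ (λ i → *-assoc β (a i) (x i))) (sym (*-distribˡ-sum β (λ i → a i * x i)))

  ·-negˡ : ∀ {m} (a x : Fin m → Carrier) → (λ i → - a i) · x ≈ - (a · x)
  ·-negˡ a x = trans (sum-cong-≋ (λ i → sym (-‿distribˡ-* (a i) (x i)))) (sum-neg (λ i → a i * x i))

  ·-+ˡ : ∀ {m} (a b x : Fin m → Carrier) → (λ i → a i + b i) · x ≈ a · x + b · x
  ·-+ˡ a b x = trans (sum-cong-≋ (λ i → distribʳ (x i) (a i) (b i))) (∑-distrib-+ (λ i → a i * x i) (λ i → b i * x i))

  ·-subˡ : ∀ {m} (a b x : Fin m → Carrier) → (λ i → a i - b i) · x ≈ a · x - b · x
  ·-subˡ a b x = trans (sum-cong-≋ (λ i → [y-z]x≈yx-zx (x i) (a i) (b i))) (sum-sub (λ i → a i * x i) (λ i → b i * x i))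

  ·-subʳ : ∀ {m} (a x β : Fin m → Carrier) y → a · (λ i → x i - β i * y) ≈ a · x - (a · β) * y
  ·-subʳ a x β y = begin
    a · (λ i → x i - β i * y)                  ≈⟨ sum-cong-≋ (λ i → x[y-z]≈xy-xz (a i) (x i) (β i * y)) ⟩
    sum (λ i → a i * x i - a i * (β i * y))    ≈⟨ sum-sub (λ i → a i * x i) (λ i → a i * (β i * y)) ⟩
    a · x - sum (λ i → a i * (β i * y))        ≈⟨ +-congˡ (-‿cong (sum-cong-≋ (λ i → *-assoc (a i) (β i) y))) ⟨
    a · x - sum (λ i → a i * β i * y)          ≈⟨ +-congˡ (-‿cong (*-distribʳ-sum y (λ i → a i * β i))) ⟨
    a · x - (a · β) * y                        ∎

  ·-remove : ∀ {m} (a x : Fin (suc m) → Carrier) p → a · x ≈ a p * x p + (a ∘ punchIn p) · (x ∘ punchIn p)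
  ·-remove a x p = sum-remove {i = p} (λ i → a i * x i)

  ·-insertAt : ∀ {m} (a : Fin m → Carrier) p β x → insertAt a p β · x ≈ β * x p + a · (x ∘ punchIn p)
  ·-insertAt a p β x = trans (·-remove (insertAt a p β) x p)
    (+-cong (*-congʳ (reflexive (insertAt-lookup a p β)))
            (·-congˡ (x ∘ punchIn p) (λ j → reflexive (insertAt-punchIn a p β j))))

  ·-exchange : ∀ {k m} (a : Fin k → Carrier) (b : Fin m → Carrier) (M : Fin k → Fin m → Carrier) →
    a · (λ i → b · M i) ≈ b · (λ j → a · (λ i → M i j))
  ·-exchange a b M = begin
    sum (λ i → a i * sum (λ j → b j * M i j))
      ≈⟨ sum-cong-≋ (λ i → *-distribˡ-sum (a i) (λ j → b j * M i j)) ⟩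
    sum (λ i → sum (λ j → a i * (b j * M i j)))
      ≈⟨ ∑-comm (λ i j → a i * (b j * M i j)) ⟩
    sum (λ j → sum (λ i → a i * (b j * M i j)))
      ≈⟨ sum-cong-≋ (λ j → sum-cong-≋ (λ i → *-CS.x∙yz≈y∙xz (a i) (b j) (M i j))) ⟩
    sum (λ j → sum (λ i → b j * (a i * M i j)))
      ≈⟨ sum-cong-≋ (λ j → *-distribˡ-sum (b j) (λ i → a i * M i j)) ⟨
    sum (λ j → b j * sum (λ i → a i * M i j))
      ∎

  ·-assoc : ∀ {k m} (a : Fin k → Carrier) (M : Fin k → Fin m → Carrier) x →
    (λ j → a · (λ i → M i j)) · x ≈ a · (λ i → M i · x)
  ·-assoc a M x = begin
    (λ j → a · (λ i → M i j)) · x   ≈⟨ ·-comm _ x ⟩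
    x · (λ j → a · (λ i → M i j))   ≈⟨ ·-exchange a x M ⟨
    a · (λ i → x · M i)             ≈⟨ ·-congʳ a (λ i → ·-comm x (M i)) ⟩
    a · (λ i → M i · x)             ∎

  δ : ∀ {m} → Fin m → Fin m → Carrier
  δ zero    zero    = 1#
  δ zero    (suc j) = 0#
  δ (suc i) zero    = 0#
  δ (suc i) (suc j) = δ i j

  δ-refl : ∀ {m} (i : Fin m) → δ i i ≡ 1#
  δ-refl zero    = ≡.refl
  δ-refl (suc i) = δ-refl i

  δ-≢ : ∀ {m} {i j : Fin m} → i ≢ j → δ i j ≡ 0#
  δ-≢ {i = zero}  {zero}  i≢j = contradiction ≡.refl i≢j
  δ-≢ {i = zero}  {suc j} i≢j = ≡.refl
  δ-≢ {i = suc i} {zero}  i≢j = ≡.refl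
  δ-≢ {i = suc i} {suc j} i≢j = δ-≢ (i≢j ∘ ≡.cong suc)

  δ-sym : ∀ {m} (i j : Fin m) → δ i j ≡ δ j i
  δ-sym zero    zero    = ≡.refl
  δ-sym zero    (suc j) = ≡.refl
  δ-sym (suc i) zero    = ≡.refl
  δ-sym (suc i) (suc j) = δ-sym i j

  δ-· : ∀ {m} (k : Fin m) x → δ k · x ≈ x k
  δ-· k x = begin
    δ k · x      ≈⟨ sum-single k (λ j j≢k → trans (*-congʳ (reflexive (δ-≢ (j≢k ∘ ≡.sym)))) (zeroˡ (x j))) ⟩
    δ k k * x k  ≈⟨ *-congʳ (reflexive (δ-refl k)) ⟩
    1# * x k     ≈⟨ *-identityˡ (x k) ⟩
    x k          ∎

  ·-δ : ∀ {m} a (k : Fin m) → a · δ k ≈ a k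
  ·-δ a k = trans (·-comm a (δ k)) (δ-· k a)

  -- Coordinates range over an arbitrary set C: boundary rows get a coordinate for every face,
  -- so that complexes with different lists of faces can be compared.

  combination : ∀ {C : Set} {m} → (Fin m → Carrier) → (Fin m → C → Carrier) → C → Carrier
  combination a u t = a · (λ i → u i t)

  InSpan : ∀ {C : Set} {m} → (Fin m → C → Carrier) → (C → Carrier) → Set (c ⊔ ℓ)
  InSpan {m = m} u x = Σ (Fin m → Carrier) λ a → ∀ t → x t ≈ combination a u t

  Independent : ∀ {C : Set} {m} → (Fin m → C → Carrier) → Set (c ⊔ ℓ)
  Independent u = ∀ a → (∀ t → combination a u t ≈ 0#) → ∀ i → a i ≈ 0#

  Rank : ∀ {C : Set} {m} → (Fin m → C → Carrier) → ℕ → Set (c ⊔ ℓ)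
  Rank {m = m} u r =
    Σ (Fin r → Fin m) (λ s → Injective _≡_ _≡_ s × Independent (u ∘ s))
    × (∀ (s : Fin (suc r) → Fin m) → Injective _≡_ _≡_ s → ¬ Independent (u ∘ s))

  module _ {C : Set} where

    Vector : Set c
    Vector = C → Carrier

    Independent-cong : ∀ {m} {u v : Fin m → Vector} → (∀ i t → u i t ≈ v i t) → Independent u → Independent v
    Independent-cong u≈v ind a rel = ind a (λ t → trans (·-congʳ a (λ i → u≈v i t)) (rel t))

    push : ∀ {k m} → (Fin k → Fin m) → (Fin k → Carrier) → Fin m → Carrier
    push s a j = a · (λ i → δ (s i) j)

    combination-push : ∀ {k m} (s : Fin k → Fin m) a (u : Fin m → Vector) t →
      combination (push s a) u t ≈ combination a (u ∘ s) t
    combination-push s a u t = trans (·-assoc a (δ ∘ s) (λ j → u j t)) (·-congʳ a (λ i → δ-· (s i) (λ j → u j t)))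

    push-injective : ∀ {k m} {s : Fin k → Fin m} → Injective _≡_ _≡_ s → ∀ a i → push s a (s i) ≈ a i
    push-injective {s = s} s-inj a i = begin
      a · (λ i′ → δ (s i′) (s i))
        ≈⟨ ·-congʳ a (λ i′ → reflexive (δ-sym (s i′) (s i))) ⟩
      a · (λ i′ → δ (s i) (s i′))
        ≈⟨ sum-single i (λ i′ i′≢i → trans (*-congˡ (reflexive (δ-≢ (i′≢i ∘ ≡.sym ∘ s-inj)))) (zeroʳ _)) ⟩
      a i * δ (s i) (s i)
        ≈⟨ *-congˡ (reflexive (δ-refl (s i))) ⟩
      a i * 1#
        ≈⟨ *-identityʳ (a i) ⟩
      a i
        ∎

    independent-∘ : ∀ {k m} {u : Fin m → Vector} {s : Fin k → Fin m} → Injective _≡_ _≡_ s →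
      Independent u → Independent (u ∘ s)
    independent-∘ {u = u} {s} s-inj ind a rel i = begin
      a i              ≈⟨ push-injective s-inj a i ⟨
      push s a (s i)   ≈⟨ ind (push s a) (λ t → trans (combination-push s a u t) (rel t)) (s i) ⟩
      0#               ∎

    independent-prefix : ∀ {k m} {u : Fin m → Vector} (k≤m : k ℕ.≤ m) → Independent u →
      Independent (λ i → u (inject≤ i k≤m))
    independent-prefix k≤m = independent-∘ (Fin.inject≤-injective k≤m k≤m _ _)

    independent⇒≤rank : ∀ {k m r} {u : Fin m → Vector} {s : Fin k → Fin m} → Injective _≡_ _≡_ s →
      Independent (u ∘ s) → Rank u r → k ℕ.≤ r
    independent⇒≤rank {k} {r = r} {s = s} s-inj ind (_ , maximal) with k ℕ.≤? r
    ... | yes k≤r = k≤r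
    ... | no  k≰r = ⊥-elim (maximal (s ∘ ι) (ι-injective ∘ s-inj) (independent-prefix r<k ind))
      where
      r<k = ℕ.≰⇒> k≰r
      ι : Fin (suc r) → Fin k
      ι i = inject≤ i r<k
      ι-injective : Injective _≡_ _≡_ ι
      ι-injective = Fin.inject≤-injective r<k r<k _ _

    inSpan-member : ∀ {m} (u : Fin m → Vector) i → InSpan u (u i)
    inSpan-member u i = δ i , λ t → sym (δ-· i (λ j → u j t))

    inSpan-trans : ∀ {k m} {u : Fin k → Vector} {v : Fin m → Vector} {x : Vector} →
      InSpan u x → (∀ i → InSpan v (u i)) → InSpan v x
    inSpan-trans {u = u} {v} {x} (a , x≈au) u∈v = (λ j → a · (λ i → b i j)) , λ t → begin
      x t                                         ≈⟨ x≈au t ⟩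
      a · (λ i → u i t)                           ≈⟨ ·-congʳ a (λ i → proj₂ (u∈v i) t) ⟩
      a · (λ i → b i · (λ j → v j t))             ≈⟨ ·-assoc a b (λ j → v j t) ⟨
      (λ j → a · (λ i → b i j)) · (λ j → v j t)   ∎
      where
      b = λ i → proj₁ (u∈v i)

    relation⇒inSpan : ∀ {m k} {u : Fin m → Vector} {v : Fin k → Vector} z p →
      (∀ t → combination z u t ≈ 0#) → ¬ (z p ≈ 0#) → (∀ i → i ≢ p → InSpan v (u i)) → InSpan v (u p)
    relation⇒inSpan {suc m} {u = u} z p rel zₚ≉0 others∈v =
      inSpan-trans uₚ∈others (λ j → others∈v (punchIn p j) (Fin.punchInᵢ≢i p j))
      where
      zₚ⁻¹ = z p ⁻¹⟨ zₚ≉0 ⟩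
      z′ = z ∘ punchIn p
      u′ = λ t j → u (punchIn p j) t
      uₚ∈others : InSpan (u ∘ punchIn p) (u p)
      uₚ∈others = (λ j → - (zₚ⁻¹ * z′ j)) , λ t → begin
        u p t
          ≈⟨ ⁻¹-cancelˡ (z p) zₚ≉0 (u p t) ⟨
        zₚ⁻¹ * (z p * u p t)
          ≈⟨ *-congˡ (+-inverseˡ-unique _ _ (trans (sym (·-remove z (λ i → u i t) p)) (rel t))) ⟩
        zₚ⁻¹ * - (z′ · u′ t)
          ≈⟨ -‿distribʳ-* zₚ⁻¹ _ ⟨
        - (zₚ⁻¹ * z′ · u′ t)
          ≈⟨ -‿cong (·-scaleˡ zₚ⁻¹ z′ (u′ t)) ⟨
        - ((λ j → zₚ⁻¹ * z′ j) · u′ t)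
          ≈⟨ ·-negˡ _ (u′ t) ⟨
        (λ j → - (zₚ⁻¹ * z′ j)) · u′ t
          ∎

    inSpan⇒dependent : ∀ {m} {u : Fin (suc m) → Vector} p → InSpan (u ∘ punchIn p) (u p) → ¬ Independent u
    inSpan⇒dependent {u = u} p (a , uₚ≈au) ind = 0≉1 (begin
      0#    ≈⟨ ind b rel p ⟨
      b p   ≡⟨ insertAt-lookup _ p 1# ⟩
      1#    ∎)
      where
      b = insertAt (λ j → - a j) p 1#
      rel : ∀ t → combination b u t ≈ 0#
      rel t = begin
        b · (λ i → u i t)
          ≈⟨ ·-insertAt (λ j → - a j) p 1# (λ i → u i t) ⟩
        1# * u p t + (λ j → - a j) · (λ j → u (punchIn p j) t)
          ≈⟨ +-cong (*-identityˡ _) (·-negˡ a (λ j → u (punchIn p j) t)) ⟩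
        u p t - combination a (u ∘ punchIn p) t
          ≈⟨ +-congʳ (uₚ≈au t) ⟩
        combination a (u ∘ punchIn p) t - combination a (u ∘ punchIn p) t
          ≈⟨ -‿inverseʳ _ ⟩
        0#
          ∎

    inSpan-eliminate : ∀ {m} {u : Fin (suc m) → Vector} {x y : Vector} β (a b : Fin (suc m) → Carrier) →
      (∀ t → x t ≈ combination a u t) → (∀ t → y t ≈ combination b u t) → a zero ≈ β * b zero →
      InSpan (u ∘ suc) (λ t → x t - β * y t)
    inSpan-eliminate {u = u} {x} {y} β a b x≈au y≈bu a₀≈βb₀ = (λ k → a′ k - β * b′ k) , λ t → begin
      x t - β * y t
        ≈⟨ +-cong (x≈au t) (-‿cong (*-congˡ (y≈bu t))) ⟩
      (a zero * u zero t + a′ · u′ t) - β * (b zero * u zero t + b′ · u′ t)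
        ≈⟨ +-congˡ (-‿cong (trans (distribˡ β _ _)
             (+-congʳ (trans (sym (*-assoc β (b zero) (u zero t))) (*-congʳ (sym a₀≈βb₀)))))) ⟩
      (a zero * u zero t + a′ · u′ t) - (a zero * u zero t + β * (b′ · u′ t))
        ≈⟨ [x+y]-[x+z]≈y-z _ _ _ ⟩
      a′ · u′ t - β * (b′ · u′ t)
        ≈⟨ +-congˡ (-‿cong (·-scaleˡ β b′ (u′ t))) ⟨
      a′ · u′ t - (λ k → β * b′ k) · u′ t
        ≈⟨ ·-subˡ a′ (λ k → β * b′ k) (u′ t) ⟨
      (λ k → a′ k - β * b′ k) · u′ t
        ∎
      where
      a′ = a ∘ suc
      b′ = b ∘ suc
      u′ = λ t k → u (suc k) t

    independent-eliminate : ∀ {m} {w : Fin (suc m) → Vector} p (β : Fin m → Carrier) → Independent w →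
      Independent (λ i t → w (punchIn p i) t - β i * w p t)
    independent-eliminate {w = w} p β ind a rel i = begin
      a i               ≡⟨ insertAt-punchIn a p _ i ⟨
      b (punchIn p i)   ≈⟨ ind b rel′ (punchIn p i) ⟩
      0#                ∎
      where
      b = insertAt a p (- (a · β))
      rel′ : ∀ t → combination b w t ≈ 0#
      rel′ t = begin
        b · (λ i → w i t)                                   ≈⟨ ·-insertAt a p _ (λ i → w i t) ⟩
        - (a · β) * w p t + a · (λ i → w (punchIn p i) t)   ≈⟨ +-comm _ _ ⟩
        a · (λ i → w (punchIn p i) t) + - (a · β) * w p t   ≈⟨ +-congˡ (-‿distribˡ-* (a · β) (w p t)) ⟨
        a · (λ i → w (punchIn p i) t) - (a · β) * w p t     ≈⟨ ·-subʳ a (λ i → w (punchIn p i) t) β (w p t) ⟨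
        a · (λ i → w (punchIn p i) t - β i * w p t)         ≈⟨ rel t ⟩
        0#                                                  ∎

    steinitz : ∀ r (u : Fin r → Vector) (w : Fin (suc r) → Vector) → (∀ i → InSpan u (w i)) → ¬ Independent w
    steinitz zero    u w w∈u ind = 0≉1 (sym (ind (λ _ → 1#) rel zero))
      where
      rel : ∀ t → combination (λ _ → 1#) w t ≈ 0#
      rel t = trans (+-identityʳ _) (trans (*-identityˡ _) (proj₂ (w∈u zero) t))
    steinitz (suc r) u w w∈u ind = ¬¬-excluded-middle {A = ∃ λ p → ¬ (a p zero ≈ 0#)} λ where
        (yes (p , aₚ₀≉0)) → pivotOn p aₚ₀≉0
        (no ¬pivot)       → ¬¬-Π-Fin (λ p aₚ₀≉0 → ¬pivot (p , aₚ₀≉0)) noPivot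
      where
      a : Fin (suc (suc r)) → Fin (suc r) → Carrier
      a i = proj₁ (w∈u i)

      noPivot : (∀ i → a i zero ≈ 0#) → ⊥
      noPivot a₀≈0 = steinitz r (u ∘ suc) (w ∘ suc) w₊∈u₊ (independent-∘ {u = w} Fin.suc-injective ind)
        where
        w₊∈u₊ : ∀ i → InSpan (u ∘ suc) (w (suc i))
        w₊∈u₊ i = a (suc i) ∘ suc , λ t →
          trans (proj₂ (w∈u (suc i)) t) (trans (+-congʳ (trans (*-congʳ (a₀≈0 (suc i))) (zeroˡ _))) (+-identityˡ _))

      pivotOn : ∀ p → ¬ (a p zero ≈ 0#) → ⊥
      pivotOn p aₚ₀≉0 = steinitz r (u ∘ suc) w′ w′∈u₊ (independent-eliminate {w = w} p β ind)
        where
        β : Fin (suc r) → Carrier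
        β i = a (punchIn p i) zero * a p zero ⁻¹⟨ aₚ₀≉0 ⟩
        βaₚ₀≈aᵢ₀ : ∀ i → β i * a p zero ≈ a (punchIn p i) zero
        βaₚ₀≈aᵢ₀ i = trans (*-assoc _ _ _) (trans (*-congˡ (⁻¹-inverseˡ (a p zero) aₚ₀≉0)) (*-identityʳ _))
        w′ : Fin (suc r) → Vector
        w′ i t = w (punchIn p i) t - β i * w p t
        w′∈u₊ : ∀ i → InSpan (u ∘ suc) (w′ i)
        w′∈u₊ i = inSpan-eliminate {u = u} (β i) (a (punchIn p i)) (a p)
          (proj₂ (w∈u (punchIn p i))) (proj₂ (w∈u p)) (sym (βaₚ₀≈aᵢ₀ i))

    independent-inSpan⇒≤ : ∀ {k r} (u : Fin k → Vector) {w : Fin r → Vector} →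
      Independent w → (∀ j → ¬ ¬ InSpan u (w j)) → r ℕ.≤ k
    independent-inSpan⇒≤ {k} {r} u {w} ind w∈u with r ℕ.≤? k
    ... | yes r≤k = r≤k
    ... | no  r≰k = ⊥-elim (¬¬-Π-Fin (λ i → w∈u (ι i)) λ w∘ι∈u →
            steinitz k u (w ∘ ι) w∘ι∈u (independent-prefix {u = w} k<r ind))
      where
      k<r = ℕ.≰⇒> r≰k
      ι : Fin (suc k) → Fin r
      ι i = inject≤ i k<r

    -- As equality in K is not decidable, a maximal
    -- independent family spans only up to double negation, and Gaussian elimination produces a
    -- dual family as the positive certificate of independence.
    module _ {n} (col : Fin n → C) (col? : ∀ t → Dec (∃ λ j → col j ≡ t)) where

      Supported : Vector → Set ℓ
      Supported x = ∀ t → (∀ j → col j ≢ t) → x t ≈ 0#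

      restrict : Vector → Fin n → Carrier
      restrict x = x ∘ col

      Dual : ∀ {k} → (Fin k → Vector) → Set (c ⊔ ℓ)
      Dual {k} u = Σ (Fin k → Fin n → Carrier) λ e → ∀ i l → e i · restrict (u l) ≈ δ i l

      dual⇒independent : ∀ {k} {u : Fin k → Vector} → Dual u → Independent u
      dual⇒independent {u = u} (e , e·u≈δ) a rel i = begin
        a i                                     ≈⟨ ·-δ a i ⟨
        a · δ i                                 ≈⟨ ·-congʳ a (λ l → sym (e·u≈δ i l)) ⟩
        a · (λ l → e i · restrict (u l))        ≈⟨ ·-exchange a (e i) (λ l j → u l (col j)) ⟩
        e i · (λ j → a · (λ l → u l (col j)))   ≈⟨ ·-congʳ (e i) (λ j → rel (col j)) ⟩
        e i · (λ _ → 0#)                        ≈⟨ sum-zero (λ j → zeroʳ (e i j)) ⟩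
        0#                                      ∎

      coordinates : ∀ {k} → (Fin k → Fin n → Carrier) → Vector → Fin k → Carrier
      coordinates e x l = e l · restrict x

      residual : ∀ {k} → (Fin k → Fin n → Carrier) → (Fin k → Vector) → Vector → Vector
      residual e B x t = x t - combination (coordinates e x) B t

      supported-combination : ∀ {k} (a : Fin k → Carrier) {B : Fin k → Vector} →
        (∀ l → Supported (B l)) → Supported (combination a B)
      supported-combination a B-supp t off = sum-zero (λ l → trans (*-congˡ (B-supp l t off)) (zeroʳ (a l)))

      supported-vanishing : ∀ {x : Vector} → Supported x → (∀ j → x (col j) ≈ 0#) → ∀ t → x t ≈ 0#
      supported-vanishing x-supp x∣≈0 t with col? t
      ... | yes (j , ≡.refl) = x∣≈0 j
      ... | no  ∄j           = x-supp t (λ j col≡t → ∄j (j , col≡t))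

      residual≈0⇒inSpan : ∀ {k} (e : Fin k → Fin n → Carrier) {B : Fin k → Vector} {x : Vector} →
        Supported x → (∀ l → Supported (B l)) → (∀ j → residual e B x (col j) ≈ 0#) → InSpan B x
      residual≈0⇒inSpan e {B} {x} x-supp B-supp res≈0 =
        coordinates e x , λ t → x∙y⁻¹≈ε⇒x≈y _ _ (supported-vanishing res-supp res≈0 t)
        where
        res-supp : Supported (residual e B x)
        res-supp t off = begin
          x t - combination (coordinates e x) B t
            ≈⟨ +-cong (x-supp t off) (-‿cong (supported-combination _ B-supp t off)) ⟩
          0# - 0#
            ≈⟨ -‿inverseʳ 0# ⟩
          0#
            ∎

      extendDual : ∀ {k} {u : Fin (suc k) → Vector} (e : Fin k → Fin n → Carrier) →
        (∀ i l → e i · restrict (u (suc l)) ≈ δ i l) → ∀ j₀ →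
        ¬ (residual e (u ∘ suc) (u zero) (col j₀) ≈ 0#) → Dual u
      extendDual {k} {u} e dual j₀ γ≉0 = e′ , dual′
        where
        B = u ∘ suc
        x = u zero
        γ⁻¹ = residual e B x (col j₀) ⁻¹⟨ γ≉0 ⟩
        U : Fin k → Carrier
        U l = B l (col j₀)
        ψ : Fin n → Carrier
        ψ j = γ⁻¹ * (δ j₀ j - U · (λ l → e l j))
        e′ : Fin (suc k) → Fin n → Carrier
        e′ zero      = ψ
        e′ (suc i) j = e i j - coordinates e x i * ψ j

        ψ· : ∀ z → ψ · restrict z ≈ γ⁻¹ * (z (col j₀) - U · (λ l → e l · restrict z))
        ψ· z = begin
          ψ · restrict z
            ≈⟨ ·-scaleˡ γ⁻¹ (λ j → δ j₀ j - U · (λ l → e l j)) (restrict z) ⟩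
          γ⁻¹ * ((λ j → δ j₀ j - U · (λ l → e l j)) · restrict z)
            ≈⟨ *-congˡ (·-subˡ (δ j₀) (λ j → U · (λ l → e l j)) (restrict z)) ⟩
          γ⁻¹ * (δ j₀ · restrict z - (λ j → U · (λ l → e l j)) · restrict z)
            ≈⟨ *-congˡ (+-cong (δ-· j₀ (restrict z)) (-‿cong (·-assoc U e (restrict z)))) ⟩
          γ⁻¹ * (z (col j₀) - U · (λ l → e l · restrict z))
            ∎

        ψ·x≈1 : ψ · restrict x ≈ 1#
        ψ·x≈1 = begin
          ψ · restrict x
            ≈⟨ ψ· x ⟩
          γ⁻¹ * (x (col j₀) - U · coordinates e x)
            ≈⟨ *-congˡ (+-congˡ (-‿cong (·-comm U (coordinates e x)))) ⟩
          γ⁻¹ * residual e B x (col j₀)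
            ≈⟨ ⁻¹-inverseˡ _ γ≉0 ⟩
          1#
            ∎

        ψ·B≈0 : ∀ m → ψ · restrict (B m) ≈ 0#
        ψ·B≈0 m = begin
          ψ · restrict (B m)
            ≈⟨ ψ· (B m) ⟩
          γ⁻¹ * (U m - U · (λ l → e l · restrict (B m)))
            ≈⟨ *-congˡ (+-congˡ (-‿cong (·-congʳ U (λ l → trans (dual l m) (reflexive (δ-sym l m)))))) ⟩
          γ⁻¹ * (U m - U · δ m)
            ≈⟨ *-congˡ (+-congˡ (-‿cong (·-δ U m))) ⟩
          γ⁻¹ * (U m - U m)
            ≈⟨ *-congˡ (-‿inverseʳ (U m)) ⟩
          γ⁻¹ * 0#
            ≈⟨ zeroʳ γ⁻¹ ⟩
          0#
            ∎

        e′₊· : ∀ i z → e′ (suc i) · restrict z ≈ e i · restrict z - coordinates e x i * (ψ · restrict z)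
        e′₊· i z = trans (·-subˡ (e i) (λ j → coordinates e x i * ψ j) (restrict z))
                         (+-congˡ (-‿cong (·-scaleˡ (coordinates e x i) ψ (restrict z))))

        dual′ : ∀ i l → e′ i · restrict (u l) ≈ δ i l
        dual′ zero    zero    = ψ·x≈1
        dual′ zero    (suc m) = ψ·B≈0 m
        dual′ (suc i) zero    = begin
          e′ (suc i) · restrict x
            ≈⟨ e′₊· i x ⟩
          coordinates e x i - coordinates e x i * (ψ · restrict x)
            ≈⟨ +-congˡ (-‿cong (trans (*-congˡ ψ·x≈1) (*-identityʳ _))) ⟩
          coordinates e x i - coordinates e x i
            ≈⟨ -‿inverseʳ _ ⟩
          0#
            ∎
        dual′ (suc i) (suc m) = begin
          e′ (suc i) · restrict (B m)
            ≈⟨ e′₊· i (B m) ⟩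
          e i · restrict (B m) - coordinates e x i * (ψ · restrict (B m))
            ≈⟨ +-cong (dual i m) (-‿cong (trans (*-congˡ (ψ·B≈0 m)) (zeroʳ _))) ⟩
          δ i m - 0#
            ≈⟨ trans (+-congˡ -0#≈0#) (+-identityʳ _) ⟩
          δ i m
            ∎

      extend-or-inSpan : ∀ {k} {u : Fin (suc k) → Vector} → (∀ l → Supported (u l)) → Dual (u ∘ suc) →
        ¬ ¬ (Dual u ⊎ InSpan (u ∘ suc) (u zero))
      extend-or-inSpan {u = u} supp (e , dual) ¬either =
        ¬¬-excluded-middle {A = ∃ λ j → ¬ (residual e (u ∘ suc) (u zero) (col j) ≈ 0#)} λ where
          (yes (j₀ , γ≉0)) → ¬either (inj₁ (extendDual {u = u} e dual j₀ γ≉0))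
          (no  ¬pivot)     → ¬¬-Π-Fin (λ j γ≉0 → ¬pivot (j , γ≉0)) λ res≈0 →
                               ¬either (inj₂ (residual≈0⇒inSpan e (supp zero) (supp ∘ suc) res≈0))

      independent⇒¬¬dual : ∀ {k} {u : Fin k → Vector} → (∀ l → Supported (u l)) → Independent u → ¬ ¬ Dual u
      independent⇒¬¬dual {zero}      _    _   ¬dual = ¬dual ((λ ()) , λ ())
      independent⇒¬¬dual {suc k} {u} supp ind ¬dual =
        independent⇒¬¬dual (supp ∘ suc) (independent-∘ {u = u} Fin.suc-injective ind) λ dual₊ →
          extend-or-inSpan supp dual₊ λ where
            (inj₁ dual)  → ¬dual dual
            (inj₂ u₀∈u₊) → inSpan⇒dependent {u = u} zero u₀∈u₊ ind

      maximal-independent⇒¬¬inSpan : ∀ {k} {B : Fin k → Vector} {x : Vector} →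
        (∀ l → Supported (B l)) → Supported x → Independent B → ¬ Independent (insertAt B zero x) →
        ¬ ¬ InSpan B x
      maximal-independent⇒¬¬inSpan {B = B} {x} B-supp x-supp B-ind ¬ind ¬x∈B =
        independent⇒¬¬dual B-supp B-ind λ dual →
          extend-or-inSpan {u = insertAt B zero x} supp dual λ where
            (inj₁ dual′) → ¬ind (dual⇒independent {u = insertAt B zero x} dual′)
            (inj₂ x∈B)   → ¬x∈B x∈B
        where
        supp : ∀ l → Supported (insertAt B zero x l)
        supp zero    = x-supp
        supp (suc l) = B-supp l

      rank-mono : ∀ {m m′ r r′} {u : Fin m → Vector} {w : Fin m′ → Vector} → (∀ l → Supported (u l)) →
        (∀ j → InSpan u (w j)) → Rank u r → Rank w r′ → r′ ℕ.≤ r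
      rank-mono {u = u} {w} supp w∈u ((s , s-inj , basis) , maximal) ((s′ , _ , ind′) , _) =
        independent-inSpan⇒≤ (u ∘ s) ind′ (w∈basis ∘ s′)
        where
        u∈basis : ∀ l → ¬ ¬ InSpan (u ∘ s) (u l)
        u∈basis l with Fin.any? (λ k → s k Fin.≟ l)
        ... | yes (k , ≡.refl) = λ ¬u∈basis → ¬u∈basis (inSpan-member (u ∘ s) k)
        ... | no  l∉s          = maximal-independent⇒¬¬inSpan (supp ∘ s) (supp l) basis ¬ind
          where
          s⁺ : Fin (suc _) → Fin _
          s⁺ = insertAt s zero l
          s⁺-injective : Injective _≡_ _≡_ s⁺
          s⁺-injective {zero}  {zero}  _     = ≡.refl
          s⁺-injective {zero}  {suc j} l≡sⱼ = contradiction (j , ≡.sym l≡sⱼ) l∉s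
          s⁺-injective {suc i} {zero}  sᵢ≡l = contradiction (i , sᵢ≡l) l∉s
          s⁺-injective {suc i} {suc j} sᵢ≡sⱼ = ≡.cong suc (s-inj sᵢ≡sⱼ)
          ¬ind : ¬ Independent (insertAt (u ∘ s) zero (u l))
          ¬ind ind = maximal s⁺ s⁺-injective
            (Independent-cong {u = insertAt (u ∘ s) zero (u l)} {v = u ∘ s⁺} (λ { zero t → refl ; (suc i) t → refl }) ind)
        w∈basis : ∀ j → ¬ ¬ InSpan (u ∘ s) (w j)
        w∈basis j ¬w∈basis = ¬¬-Π-Fin u∈basis λ u∈basis′ → ¬w∈basis (inSpan-trans (w∈u j) u∈basis′)

      independent-restrict⇒independent : ∀ {k} {u : Fin k → Vector} →
        Independent (restrict ∘ u) → Independent u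
      independent-restrict⇒independent ind a rel = ind a (λ j → rel (col j))

      independent⇒independent-restrict : ∀ {k} {u : Fin k → Vector} → (∀ l → Supported (u l)) →
        Independent u → Independent (restrict ∘ u)
      independent⇒independent-restrict {u = u} supp ind a rel =
        ind a (supported-vanishing (supported-combination a supp) rel)

      rank-restrict⇒rank : ∀ {k r} {u : Fin k → Vector} → (∀ l → Supported (u l)) →
        Rank (restrict ∘ u) r → Rank u r
      rank-restrict⇒rank supp ((s , s-inj , ind) , maximal) =
        (s , s-inj , independent-restrict⇒independent ind) ,
        λ s′ s′-inj ind′ → maximal s′ s′-inj (independent⇒independent-restrict (supp ∘ s′) ind′)

  independent⇒linIndependent : ∀ {m n} {v : Fin m → Fin n → Carrier} → Independent v → LinIndependent v
  independent⇒linIndependent {v = v} ind a rel = ind a (λ t → trans (reflexive (≡.sym (sumF≡sum (λ i → a i * v i t)))) (rel t))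

  linIndependent⇒independent : ∀ {m n} {v : Fin m → Fin n → Carrier} → LinIndependent v → Independent v
  linIndependent⇒independent {v = v} ind a rel = ind a (λ t → trans (reflexive (sumF≡sum (λ i → a i * v i t))) (rel t))

  hasRank⇒rank : ∀ {m n r} {v : Fin m → Fin n → Carrier} → HasRank v r → Rank v r
  hasRank⇒rank {v = v} ((s , s-inj , ind) , maximal) =
    (s , s-inj , linIndependent⇒independent ind) ,
    λ s′ s′-inj ind′ → maximal s′ s′-inj (independent⇒linIndependent {v = v ∘ s′} ind′)

_≟F_ : (σ τ : Face) → Dec (σ ≡ τ)
_≟F_ = ≡-dec ℕ._≟_

Unique⇒lookup-injective : ∀ {A : Set} {xs : List A} → Unique xs → Injective _≡_ _≡_ (lookup xs)
Unique⇒lookup-injective {xs = x ∷ xs} (x∉xs ∷ u) {zero}  {zero}  _ = ≡.refl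
Unique⇒lookup-injective {xs = x ∷ xs} (x∉xs ∷ u) {zero}  {suc j} e = contradiction e (All.lookup x∉xs (∈-lookup j))
Unique⇒lookup-injective {xs = x ∷ xs} (x∉xs ∷ u) {suc i} {zero}  e = contradiction (≡.sym e) (All.lookup x∉xs (∈-lookup i))
Unique⇒lookup-injective {xs = x ∷ xs} (x∉xs ∷ u) {suc i} {suc j} e = ≡.cong suc (Unique⇒lookup-injective u e)

reindex : ∀ {A : Set} {xs ys : List A} → xs ⊆ ys → Fin (length xs) → Fin (length ys)
reindex xs⊆ys i = index (xs⊆ys (∈-lookup i))

lookup-reindex : ∀ {A : Set} {xs ys : List A} (xs⊆ys : xs ⊆ ys) i → lookup ys (reindex xs⊆ys i) ≡ lookup xs i
lookup-reindex xs⊆ys i = ≡.sym (lookup-index (xs⊆ys (∈-lookup i)))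

reindex-injective : ∀ {A : Set} {xs ys : List A} (xs⊆ys : xs ⊆ ys) → Unique xs → Injective _≡_ _≡_ (reindex xs⊆ys)
reindex-injective {ys = ys} xs⊆ys u {i} {j} e = Unique⇒lookup-injective u
  (≡.trans (≡.sym (lookup-reindex xs⊆ys i)) (≡.trans (≡.cong (lookup ys) e) (lookup-reindex xs⊆ys j)))

length-mono-⊆ : ∀ {A : Set} {xs ys : List A} → Unique xs → xs ⊆ ys → length xs ≤ length ys
length-mono-⊆ u xs⊆ys = Fin.injective⇒≤ (reindex-injective xs⊆ys u)

length-cong-⊆⊇ : ∀ {A : Set} {xs ys : List A} → Unique xs → Unique ys → xs ⊆ ys → ys ⊆ xs → length xs ≡ length ys
length-cong-⊆⊇ u v xs⊆ys ys⊆xs = ℕ.≤-antisym (length-mono-⊆ u xs⊆ys) (length-mono-⊆ v ys⊆xs)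

AllPairs-lookup : ∀ {A : Set} {R : A → A → Set} {xs : List A} → AllPairs R xs →
  ∀ {x y} → x ∈ xs → y ∈ xs → x ≢ y → R x y ⊎ R y x
AllPairs-lookup (_   ∷ _)  (here ≡.refl) (here ≡.refl) x≢y = contradiction ≡.refl x≢y
AllPairs-lookup (Rx  ∷ _)  (here ≡.refl) (there y∈)  _   = inj₁ (All.lookup Rx y∈)
AllPairs-lookup (Ry  ∷ _)  (there x∈)  (here ≡.refl) _   = inj₂ (All.lookup Ry x∈)
AllPairs-lookup (_   ∷ Rs) (there x∈)  (there y∈)  x≢y = AllPairs-lookup Rs x∈ y∈ x≢y

⊑-length : ∀ {σ τ : Face} → σ ⊑ τ → length σ ≡ length τ → σ ≡ τ
⊑-length σ⊑τ |σ|≡|τ| = ≋⇒≡ (to-≋ |σ|≡|τ| σ⊑τ)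

⊑⇒⊆ : ∀ {σ τ : Face} → σ ⊑ τ → σ ⊆ τ
⊑⇒⊆ σ⊑τ = Any-resp-⊆ σ⊑τ

∈-subfaces⁻ : ∀ {σ} G → σ ∈ subfaces G → σ ⊑ G
∈-subfaces⁻ [] (here ≡.refl) = []
∈-subfaces⁻ (v ∷ G) σ∈ with ∈-++⁻ (subfaces G) σ∈
... | inj₁ σ∈G = v ∷ʳ ∈-subfaces⁻ G σ∈G
... | inj₂ σ∈vG with ∈-map⁻ (v ∷_) σ∈vG
...   | τ , τ∈G , ≡.refl = ≡.refl ∷ ∈-subfaces⁻ G τ∈G

∈-subfaces⁺ : ∀ {σ G} → σ ⊑ G → σ ∈ subfaces G
∈-subfaces⁺ []                    = here ≡.refl
∈-subfaces⁺ {G = v ∷ G} (v ∷ʳ σ⊑G)  = ∈-++⁺ˡ (∈-subfaces⁺ σ⊑G)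
∈-subfaces⁺ {G = v ∷ G} (≡.refl ∷ σ⊑G) = ∈-++⁺ʳ (subfaces G) (∈-map⁺ (v ∷_) (∈-subfaces⁺ σ⊑G))

∈-⟨⟩⁻ : ∀ {σ} L → σ ∈ ⟨ L ⟩ → ∃ λ G → G ∈ L × σ ⊑ G
∈-⟨⟩⁻ L σ∈ with find (∈-concatMap⁻ subfaces {xs = L} (∈-deduplicate⁻ (≡-dec ℕ._≟_) (concatMap subfaces L) σ∈))
... | G , G∈L , σ∈G = G , G∈L , ∈-subfaces⁻ G σ∈G

∈-⟨⟩⁺ : ∀ {σ G} L → G ∈ L → σ ⊑ G → σ ∈ ⟨ L ⟩
∈-⟨⟩⁺ L G∈L σ⊑G = ∈-deduplicate⁺ (≡-dec ℕ._≟_) (∈-concatMap⁺ subfaces {xs = L} (lose G∈L (∈-subfaces⁺ σ⊑G)))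

∈-⟨[_]⟩⁻ : ∀ {σ} F → σ ∈ ⟨ F ∷ [] ⟩ → σ ⊑ F
∈-⟨[ F ]⟩⁻ σ∈ with ∈-⟨⟩⁻ (F ∷ []) σ∈
... | _ , here ≡.refl , σ⊑F = σ⊑F

∈-⟨[_]⟩⁺ : ∀ {σ} F → σ ⊑ F → σ ∈ ⟨ F ∷ [] ⟩
∈-⟨[ F ]⟩⁺ = ∈-⟨⟩⁺ (F ∷ []) (here ≡.refl)

⟨⟩-unique : ∀ L → Unique ⟨ L ⟩
⟨⟩-unique L = deduplicate-! (concatMap subfaces L)

Closed : Complex → Set
Closed Δ = ∀ {σ τ} → σ ∈ Δ → τ ⊑ σ → τ ∈ Δ

⟨⟩-closed : ∀ L → Closed ⟨ L ⟩
⟨⟩-closed L σ∈ τ⊑σ with ∈-⟨⟩⁻ L σ∈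
... | G , G∈L , σ⊑G = ∈-⟨⟩⁺ L G∈L (⊆-trans τ⊑σ σ⊑G)

∈-∩⁻ : ∀ {σ} Δ₁ Δ₂ → σ ∈ Δ₁ ∩ Δ₂ → σ ∈ Δ₁ × σ ∈ Δ₂
∈-∩⁻ Δ₁ Δ₂ = ∈-filter⁻ (_∈? Δ₂)

∈-∩⁺ : ∀ {σ} Δ₁ Δ₂ → σ ∈ Δ₁ → σ ∈ Δ₂ → σ ∈ Δ₁ ∩ Δ₂
∈-∩⁺ Δ₁ Δ₂ = ∈-filter⁺ (_∈? Δ₂)

∩-unique : ∀ Δ₁ Δ₂ → Unique Δ₁ → Unique (Δ₁ ∩ Δ₂)
∩-unique Δ₁ Δ₂ = Unique.filter⁺ (_∈? Δ₂)

∩-closed : ∀ Δ₁ Δ₂ → Closed Δ₁ → Closed Δ₂ → Closed (Δ₁ ∩ Δ₂)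
∩-closed Δ₁ Δ₂ cl₁ cl₂ σ∈ τ⊑σ with ∈-∩⁻ Δ₁ Δ₂ σ∈
... | σ∈₁ , σ∈₂ = ∈-∩⁺ Δ₁ Δ₂ (cl₁ σ∈₁ τ⊑σ) (cl₂ σ∈₂ τ⊑σ)

∈-faces⁻ : ∀ {σ} j Δ → σ ∈ faces j Δ → σ ∈ Δ × length σ ≡ j
∈-faces⁻ j Δ = ∈-filter⁻ (λ σ → length σ ℕ.≟ j)

∈-faces⁺ : ∀ {σ} j Δ → σ ∈ Δ → length σ ≡ j → σ ∈ faces j Δ
∈-faces⁺ j Δ = ∈-filter⁺ (λ σ → length σ ℕ.≟ j)

faces-unique : ∀ j Δ → Unique Δ → Unique (faces j Δ)
faces-unique j Δ = Unique.filter⁺ (λ σ → length σ ℕ.≟ j)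

∈-bd⁻ : ∀ σ {i ω} → (i , ω) ∈ bd σ → ω ⊑ σ × suc (length ω) ≡ length σ
∈-bd⁻ (v ∷ σ) (here ≡.refl) = v ∷ʳ ⊆-refl , ≡.refl
∈-bd⁻ (v ∷ σ) (there p) with ∈-map⁻ _ p
... | (j , τ) , q , ≡.refl with ∈-bd⁻ σ q
...   | τ⊑σ , |τ|<|σ| = ≡.refl ∷ τ⊑σ , ≡.cong suc |τ|<|σ|

⊏⇒⊑bd : ∀ {σ} F → σ ⊑ F → σ ≢ F → ∃₂ λ i ω → (i , ω) ∈ bd F × σ ⊑ ω
⊏⇒⊑bd []      []            σ≢F = contradiction ≡.refl σ≢F
⊏⇒⊑bd (v ∷ F) (v ∷ʳ σ⊑F)    σ≢F = 0 , F , here ≡.refl , σ⊑F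
⊏⇒⊑bd (v ∷ F) (≡.refl ∷ σ⊑F)  σ≢F with ⊏⇒⊑bd F σ⊑F (σ≢F ∘ ≡.cong (v ∷_))
... | i , ω , iω∈ , σ⊑ω = suc i , v ∷ ω , there (∈-map⁺ _ iω∈) , ≡.refl ∷ σ⊑ω

IsFace-tail : ∀ {v F} → IsFace (v ∷ F) → IsFace F
IsFace-tail [-]      = []
IsFace-tail (_ ∷ lk) = lk

IsFace⇒head< : ∀ {v F} → IsFace (v ∷ F) → All (v <_) F
IsFace⇒head< [-]          = []
IsFace⇒head< (v<w ∷ lk) = v<w ∷ All.map (ℕ.<-trans v<w) (IsFace⇒head< lk)

IsFace⇒head∉ : ∀ {v F ρ} → IsFace (v ∷ F) → ρ ⊑ F → ∀ τ → ρ ≢ v ∷ τ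
IsFace⇒head∉ lk ρ⊑F τ ≡.refl = ℕ.<-irrefl ≡.refl (All.lookup (IsFace⇒head< lk) (⊑⇒⊆ ρ⊑F (here ≡.refl)))

bd-distinct : ∀ F → IsFace F → AllPairs (λ x y → proj₂ x ≢ proj₂ y) (bd F)
bd-distinct []      _  = []
bd-distinct (v ∷ F) lk =
  All.map⁺ (All.tabulate (λ {x} _ → IsFace⇒head∉ lk ⊆-refl (proj₂ x)))
  ∷ AllPairs.map⁺ (AllPairs.map (λ ω≢ω′ → ω≢ω′ ∘ proj₂ ∘ ∷-injective) (bd-distinct F (IsFace-tail lk)))

module Incidence {c ℓ} (K : Field c ℓ) where

  open Field K hiding (zero)
  open Homology K
  open LinearAlgebra K
  open import Algebra.Properties.Ring ring using (-0#≈0#; -‿distribˡ-*; -‿distribʳ-*; -‿involutive; -‿+-comm)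
  import Algebra.Properties.CommutativeSemigroup +-commutativeSemigroup as +-CS
  open import Relation.Binary.Reasoning.Setoid setoid

  δF : Face → Face → Carrier
  δF ρ ω with ρ ≟F ω
  ... | yes _ = 1#
  ... | no  _ = 0#

  δF-refl : ∀ ρ → δF ρ ρ ≈ 1#
  δF-refl ρ with ρ ≟F ρ
  ... | yes _   = refl
  ... | no  ρ≢ρ = contradiction ≡.refl ρ≢ρ

  δF-≢ : ∀ {ρ ω} → ρ ≢ ω → δF ρ ω ≈ 0#
  δF-≢ {ρ} {ω} ρ≢ω with ρ ≟F ω
  ... | yes ρ≡ω = contradiction ρ≡ω ρ≢ω
  ... | no  _   = refl

  δF-∷ : ∀ v ρ ω → δF (v ∷ ρ) (v ∷ ω) ≈ δF ρ ω
  δF-∷ v ρ ω = by-cases (ρ ≟F ω)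
    where
    by-cases : Dec (ρ ≡ ω) → δF (v ∷ ρ) (v ∷ ω) ≈ δF ρ ω
    by-cases (yes ≡.refl) = trans (δF-refl (v ∷ ρ)) (sym (δF-refl ρ))
    by-cases (no  ρ≢ω)    = trans (δF-≢ {v ∷ ρ} {v ∷ ω} (ρ≢ω ∘ proj₂ ∘ ∷-injective)) (sym (δF-≢ ρ≢ω))

  signedSum : List (ℕ × Face) → (Face → Carrier) → Carrier
  signedSum []             g = 0#
  signedSum ((i , ω) ∷ xs) g = sgn i * g ω + signedSum xs g

  private
    mutual
      coefAlong : Face → Face → List (ℕ × Face) → Carrier
      coefAlong σ ρ = _

      coefAlong-bd : ∀ σ ρ → coefAlong σ ρ (bd σ) ≡ coef σ ρ
      coefAlong-bd σ ρ with bd σ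
      ... | _ = ≡.refl

  -- coef σ ρ runs a local function of Defs along bd σ; coefAlong is that function, recovered
  -- by unification, so that it can be reasoned about on arbitrary lists.
  coef≈signedSum : ∀ σ ρ → coef σ ρ ≈ signedSum (bd σ) (δF ρ)
  coef≈signedSum σ ρ = trans (reflexive (≡.sym (coefAlong-bd σ ρ))) (along (bd σ))
    where
    along : ∀ xs → coefAlong σ ρ xs ≈ signedSum xs (δF ρ)
    along []             = refl
    along ((i , ω) ∷ xs) with ρ ≟F ω
    ... | yes _ = +-cong (sym (*-identityʳ (sgn i))) (along xs)
    ... | no  _ = trans (along xs) (sym (trans (+-congʳ (zeroʳ (sgn i))) (+-identityˡ _)))

  signedSum-cong : ∀ xs {g h : Face → Carrier} → (∀ {i ω} → (i , ω) ∈ xs → g ω ≈ h ω) →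
    signedSum xs g ≈ signedSum xs h
  signedSum-cong []             g≈h = refl
  signedSum-cong ((i , ω) ∷ xs) g≈h = +-cong (*-congˡ (g≈h (here ≡.refl))) (signedSum-cong xs (g≈h ∘ there))

  signedSum-zero : ∀ xs {g : Face → Carrier} → (∀ {i ω} → (i , ω) ∈ xs → g ω ≈ 0#) → signedSum xs g ≈ 0#
  signedSum-zero []             g≈0 = refl
  signedSum-zero ((i , ω) ∷ xs) g≈0 =
    trans (+-cong (trans (*-congˡ (g≈0 (here ≡.refl))) (zeroʳ (sgn i))) (signedSum-zero xs (g≈0 ∘ there))) (+-identityˡ 0#)

  signedSum-sub : ∀ xs (g h : Face → Carrier) → signedSum xs (λ ω → g ω - h ω) ≈ signedSum xs g - signedSum xs h
  signedSum-sub []             g h = sym (-‿inverseʳ 0#)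
  signedSum-sub ((i , ω) ∷ xs) g h = begin
    sgn i * (g ω - h ω) + signedSum xs (λ ω → g ω - h ω)
      ≈⟨ +-cong (trans (distribˡ (sgn i) (g ω) (- h ω)) (+-congˡ (sym (-‿distribʳ-* (sgn i) (h ω))))) (signedSum-sub xs g h) ⟩
    (sgn i * g ω - sgn i * h ω) + (signedSum xs g - signedSum xs h)
      ≈⟨ +-CS.interchange _ _ _ _ ⟩
    (sgn i * g ω + signedSum xs g) + (- (sgn i * h ω) + - signedSum xs h)
      ≈⟨ +-congˡ (-‿+-comm _ _) ⟩
    (sgn i * g ω + signedSum xs g) - (sgn i * h ω + signedSum xs h)
      ∎

  signedSum-map-cone : ∀ (f : ℕ × Face → ℕ × Face) v → (∀ i τ → f (i , τ) ≡ (suc i , v ∷ τ)) →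
    ∀ xs (g : Face → Carrier) → signedSum (map f xs) g ≈ - signedSum xs (g ∘ (v ∷_))
  signedSum-map-cone f v f≡ []             g = sym -0#≈0#
  signedSum-map-cone f v f≡ ((i , τ) ∷ xs) g rewrite f≡ i τ = begin
    - sgn i * g (v ∷ τ) + signedSum (map f xs) g
      ≈⟨ +-cong (sym (-‿distribˡ-* (sgn i) _)) (signedSum-map-cone f v f≡ xs g) ⟩
    - (sgn i * g (v ∷ τ)) + - signedSum xs (g ∘ (v ∷_))
      ≈⟨ -‿+-comm _ _ ⟩
    - (sgn i * g (v ∷ τ) + signedSum xs (g ∘ (v ∷_)))
      ∎

  signedSum-bd-∷ : ∀ v σ (g : Face → Carrier) → signedSum (bd (v ∷ σ)) g ≈ g σ - signedSum (bd σ) (g ∘ (v ∷_))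
  signedSum-bd-∷ v σ g = +-cong (*-identityˡ (g σ)) (signedSum-map-cone _ v (λ _ _ → ≡.refl) (bd σ) g)

  signedSum-δF-absent : ∀ xs {ρ} → (∀ {i ω} → (i , ω) ∈ xs → ω ≢ ρ) → signedSum xs (δF ρ) ≈ 0#
  signedSum-δF-absent xs ρ∉xs = signedSum-zero xs (λ iω∈xs → δF-≢ (ρ∉xs iω∈xs ∘ ≡.sym))

  signedSum-δF-unique : ∀ xs {i ρ} → AllPairs (λ x y → proj₂ x ≢ proj₂ y) xs → (i , ρ) ∈ xs →
    signedSum xs (δF ρ) ≈ sgn i
  signedSum-δF-unique ((i , ρ) ∷ xs) (ρ∉xs ∷ _) (here ≡.refl) = begin
    sgn i * δF ρ ρ + signedSum xs (δF ρ)
      ≈⟨ +-cong (*-congˡ (δF-refl ρ)) (signedSum-δF-absent xs (λ iω∈xs → All.lookup ρ∉xs iω∈xs ∘ ≡.sym)) ⟩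
    sgn i * 1# + 0#
      ≈⟨ trans (+-identityʳ _) (*-identityʳ (sgn i)) ⟩
    sgn i
      ∎
  signedSum-δF-unique ((j , ω) ∷ xs) {i} {ρ} (ω∉xs ∷ distinct) (there iρ∈xs) = begin
    sgn j * δF ρ ω + signedSum xs (δF ρ)
      ≈⟨ +-congʳ (trans (*-congˡ (δF-≢ (All.lookup ω∉xs iρ∈xs ∘ ≡.sym))) (zeroʳ (sgn j))) ⟩
    0# + signedSum xs (δF ρ)
      ≈⟨ +-identityˡ _ ⟩
    signedSum xs (δF ρ)
      ≈⟨ signedSum-δF-unique xs distinct iρ∈xs ⟩
    sgn i
      ∎

  sgn-nonzero : ∀ i → ¬ (sgn i ≈ 0#)
  sgn-nonzero zero    1≈0  = 0≉1 (sym 1≈0)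
  sgn-nonzero (suc i) -s≈0 = sgn-nonzero i (trans (sym (-‿involutive (sgn i))) (trans (-‿cong -s≈0) -0#≈0#))

  coef-∉bd : ∀ σ {ρ} → (∀ {i ω} → (i , ω) ∈ bd σ → ω ≢ ρ) → coef σ ρ ≈ 0#
  coef-∉bd σ ρ∉bd = trans (coef≈signedSum σ _) (signedSum-δF-absent (bd σ) ρ∉bd)

  coef-∈bd : ∀ σ {i ρ} → IsFace σ → (i , ρ) ∈ bd σ → coef σ ρ ≈ sgn i
  coef-∈bd σ σ-face iρ∈bd = trans (coef≈signedSum σ _) (signedSum-δF-unique (bd σ) (bd-distinct σ σ-face) iρ∈bd)

  cone : ℕ → (Face → Carrier) → Face → Carrier
  cone v h []      = 0#
  cone v h (w ∷ ρ) = if does (w ℕ.≟ v) then h ρ else 0#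

  cone-outside : ∀ v h ρ → (∀ τ → ρ ≢ v ∷ τ) → cone v h ρ ≈ 0#
  cone-outside v h []      _     = refl
  cone-outside v h (w ∷ ρ) ρ≢v∷ = by-cases (w ℕ.≟ v)
    where
    by-cases : (w≟v : Dec (w ≡ v)) → (if does w≟v then h ρ else 0#) ≈ 0#
    by-cases (yes ≡.refl) = contradiction ≡.refl (ρ≢v∷ ρ)
    by-cases (no  _)      = refl

  signedSum-cone≈0 : ∀ xs v (h : Face → Face → Carrier) → (∀ ρ′ → signedSum xs (λ ω → h ω ρ′) ≈ 0#) →
    ∀ ρ → signedSum xs (λ ω → cone v (h ω) ρ) ≈ 0#
  signedSum-cone≈0 xs v h Σh≈0 []      = signedSum-zero xs (λ _ → refl)
  signedSum-cone≈0 xs v h Σh≈0 (w ∷ ρ) = by-cases (w ℕ.≟ v)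
    where
    by-cases : (w≟v : Dec (w ≡ v)) → signedSum xs (λ ω → if does w≟v then h ω ρ else 0#) ≈ 0#
    by-cases (yes _) = Σh≈0 ρ
    by-cases (no  _) = signedSum-zero xs (λ _ → refl)

  signedSum-δF-cone : ∀ xs v ρ → signedSum xs (λ ω → δF ρ (v ∷ ω)) ≈ cone v (λ ρ′ → signedSum xs (δF ρ′)) ρ
  signedSum-δF-cone xs v []      = signedSum-zero xs (λ {_} {ω} _ → δF-≢ {[]} {v ∷ ω} (λ ()))
  signedSum-δF-cone xs v (w ∷ ρ) = by-cases (w ℕ.≟ v)
    where
    by-cases : (w≟v : Dec (w ≡ v)) →
      signedSum xs (λ ω → δF (w ∷ ρ) (v ∷ ω)) ≈ (if does w≟v then signedSum xs (δF ρ) else 0#)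
    by-cases (yes ≡.refl) = signedSum-cong xs (λ {_} {ω} _ → δF-∷ w ρ ω)
    by-cases (no  w≢v)    = signedSum-zero xs (λ {_} {ω} _ → δF-≢ {w ∷ ρ} {v ∷ ω} (w≢v ∘ proj₁ ∘ ∷-injective))

  coef-cone : ∀ v ω ρ → coef (v ∷ ω) ρ ≈ δF ρ ω - cone v (coef ω) ρ
  coef-cone v ω ρ = begin
    coef (v ∷ ω) ρ
      ≈⟨ coef≈signedSum (v ∷ ω) ρ ⟩
    signedSum (bd (v ∷ ω)) (δF ρ)
      ≈⟨ signedSum-bd-∷ v ω (δF ρ) ⟩
    δF ρ ω - signedSum (bd ω) (λ ω′ → δF ρ (v ∷ ω′))
      ≈⟨ +-congˡ (-‿cong (signedSum-δF-cone (bd ω) v ρ)) ⟩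
    δF ρ ω - cone v (λ ρ′ → signedSum (bd ω) (δF ρ′)) ρ
      ≈⟨ +-congˡ (-‿cong (cone-cong v ρ (λ ρ′ → coef≈signedSum ω ρ′))) ⟨
    δF ρ ω - cone v (coef ω) ρ
      ∎
    where
    cone-cong : ∀ v ρ {h h′ : Face → Carrier} → (∀ ρ′ → h ρ′ ≈ h′ ρ′) → cone v h ρ ≈ cone v h′ ρ
    cone-cong v []      h≈h′ = refl
    cone-cong v (w ∷ ρ) h≈h′ with does (w ℕ.≟ v)
    ... | true  = h≈h′ ρ
    ... | false = refl

  -- ∂(v ∗ ∂σ) = ∂σ − v ∗ ∂∂σ
  ∂[v∗∂σ]≈∂σ : ∀ v σ ρ → (∀ ρ′ → signedSum (bd σ) (λ ω → coef ω ρ′) ≈ 0#) →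
    signedSum (bd σ) (λ ω → coef (v ∷ ω) ρ) ≈ coef σ ρ
  ∂[v∗∂σ]≈∂σ v σ ρ ∂∂σ≈0 = begin
    signedSum (bd σ) (λ ω → coef (v ∷ ω) ρ)
      ≈⟨ signedSum-cong (bd σ) (λ {_} {ω} _ → coef-cone v ω ρ) ⟩
    signedSum (bd σ) (λ ω → δF ρ ω - cone v (coef ω) ρ)
      ≈⟨ signedSum-sub (bd σ) (δF ρ) (λ ω → cone v (coef ω) ρ) ⟩
    signedSum (bd σ) (δF ρ) - signedSum (bd σ) (λ ω → cone v (coef ω) ρ)
      ≈⟨ +-cong (sym (coef≈signedSum σ ρ)) (-‿cong (signedSum-cone≈0 (bd σ) v coef ∂∂σ≈0 ρ)) ⟩
    coef σ ρ - 0#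
      ≈⟨ trans (+-congˡ -0#≈0#) (+-identityʳ _) ⟩
    coef σ ρ
      ∎

  ∂∂≈0 : ∀ τ ρ → signedSum (bd τ) (λ ω → coef ω ρ) ≈ 0#
  ∂∂≈0 []      ρ = refl
  ∂∂≈0 (v ∷ τ) ρ = begin
    signedSum (bd (v ∷ τ)) (λ ω → coef ω ρ)              ≈⟨ signedSum-bd-∷ v τ (λ ω → coef ω ρ) ⟩
    coef τ ρ - signedSum (bd τ) (λ ω → coef (v ∷ ω) ρ)   ≈⟨ +-congˡ (-‿cong (∂[v∗∂σ]≈∂σ v τ ρ (∂∂≈0 τ))) ⟩
    coef τ ρ - coef τ ρ                                  ≈⟨ -‿inverseʳ _ ⟩
    0#                                                   ∎

  ·-δF : ∀ {A : List Face} → Unique A → ∀ {ω} → ω ∈ A → (g : Face → Carrier) →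
    (λ k → δF (lookup A k) ω) · (g ∘ lookup A) ≈ g ω
  ·-δF {A} A-unique {ω} ω∈A g = begin
    (λ k → δF (lookup A k) ω) · (g ∘ lookup A)
      ≈⟨ sum-single (index ω∈A) (λ k k≢ → trans (*-congʳ (δF-≢ (A[k]≢ω k≢))) (zeroˡ _)) ⟩
    δF (lookup A (index ω∈A)) ω * g (lookup A (index ω∈A))
      ≡⟨ ≡.cong (λ σ → δF σ ω * g σ) (lookup-index ω∈A) ⟨
    δF ω ω * g ω
      ≈⟨ trans (*-congʳ (δF-refl ω)) (*-identityˡ (g ω)) ⟩
    g ω
      ∎
    where
    A[k]≢ω : ∀ {k} → k ≢ index ω∈A → lookup A k ≢ ω
    A[k]≢ω k≢ A[k]≡ω = k≢ (Unique⇒lookup-injective A-unique (≡.trans A[k]≡ω (lookup-index ω∈A)))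

  signedSum-as-· : ∀ (A : List Face) → Unique A → ∀ xs → (∀ {i ω} → (i , ω) ∈ xs → ω ∈ A) → (g : Face → Carrier) →
    signedSum xs g ≈ (λ k → signedSum xs (δF (lookup A k))) · (g ∘ lookup A)
  signedSum-as-· A A-unique []             xs⊆A g = sym (sum-zero (λ k → zeroˡ (g (lookup A k))))
  signedSum-as-· A A-unique ((i , ω) ∷ xs) xs⊆A g = begin
    sgn i * g ω + signedSum xs g
      ≈⟨ +-cong (*-congˡ (·-δF A-unique (xs⊆A (here ≡.refl)) g)) (sym (signedSum-as-· A A-unique xs (xs⊆A ∘ there) g)) ⟨
    sgn i * ((λ k → δF (lookup A k) ω) · (g ∘ lookup A)) + (λ k → signedSum xs (δF (lookup A k))) · (g ∘ lookup A)
      ≈⟨ +-congʳ (·-scaleˡ (sgn i) (λ k → δF (lookup A k) ω) (g ∘ lookup A)) ⟨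
    (λ k → sgn i * δF (lookup A k) ω) · (g ∘ lookup A) + (λ k → signedSum xs (δF (lookup A k))) · (g ∘ lookup A)
      ≈⟨ ·-+ˡ _ _ (g ∘ lookup A) ⟨
    (λ k → sgn i * δF (lookup A k) ω + signedSum xs (δF (lookup A k))) · (g ∘ lookup A)
      ∎

  rows : (S : List Face) → Fin (length S) → Face → Carrier
  rows S i = coef (lookup S i)

  column? : (T : List Face) → ∀ ρ → Dec (∃ λ j → lookup T j ≡ ρ)
  column? T ρ with ρ ∈? T
  ... | yes ρ∈T = yes (index ρ∈T , ≡.sym (lookup-index ρ∈T))
  ... | no  ρ∉T = no λ (j , T[j]≡ρ) → ρ∉T (≡.subst (_∈ T) T[j]≡ρ (∈-lookup j))

  rows-supported : ∀ {Δ} j → Closed Δ → ∀ l →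
    Supported (lookup (lowerFaces Δ j)) (column? (lowerFaces Δ j)) (rows (faces j Δ) l)
  rows-supported {Δ} j closed l ρ ρ∉T = coef-∉bd σ ω∉bd
    where
    σ = lookup (faces j Δ) l
    ω∉bd : ∀ {i ω} → (i , ω) ∈ bd σ → ω ≢ ρ
    ω∉bd {ω = ω} iω∈bd ≡.refl with ∈-bd⁻ σ iω∈bd | ∈-faces⁻ j Δ (∈-lookup l)
    ... | ω⊑σ , |ω|+1≡|σ| | σ∈Δ , |σ|≡j = ρ∉T (index ω∈T) (≡.sym (lookup-index ω∈T))
      where
      ω∈T : ω ∈ lowerFaces Δ j
      ω∈T = ≡.subst (λ j → ω ∈ lowerFaces Δ j) (≡.trans |ω|+1≡|σ| |σ|≡j)
              (∈-faces⁺ (length ω) Δ (closed σ∈Δ ω⊑σ) ≡.refl)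

  hasRank⇒rank-rows : ∀ {Δ j r} → Closed Δ → HasRank (∂ Δ j) r → Rank (rows (faces j Δ)) r
  hasRank⇒rank-rows {Δ} {j} closed hasRank =
    rank-restrict⇒rank (lookup (lowerFaces Δ j)) (column? (lowerFaces Δ j)) (rows-supported j closed)
      (hasRank⇒rank {v = ∂ Δ j} hasRank)

  inSpan-rows : ∀ S {σ} → σ ∈ S → InSpan (rows S) (coef σ)
  inSpan-rows S σ∈S = ≡.subst (InSpan (rows S) ∘ coef) (≡.sym (lookup-index σ∈S)) (inSpan-member (rows S) (index σ∈S))

  rank-mono-⊆ : ∀ {S S′ r r′} → Unique S′ → S′ ⊆ S → Rank (rows S) r → Rank (rows S′) r′ → r′ ≤ r
  rank-mono-⊆ {S} {S′} S′-unique S′⊆S rank ((s′ , s′-inj , ind′) , _) =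
    independent⇒≤rank {u = rows S} {s = reindex S′⊆S ∘ s′}
      (s′-inj ∘ reindex-injective S′⊆S S′-unique)
      (Independent-cong (λ i t → reflexive (≡.cong (λ σ → coef σ t) (≡.sym (lookup-reindex S′⊆S (s′ i))))) ind′)
      rank

  rank-cong-⊆⊇ : ∀ {S S′ r r′} → Unique S → Unique S′ → S ⊆ S′ → S′ ⊆ S →
    Rank (rows S) r → Rank (rows S′) r′ → r ≡ r′
  rank-cong-⊆⊇ S-unique S′-unique S⊆S′ S′⊆S rank rank′ =
    ℕ.≤-antisym (rank-mono-⊆ S-unique S⊆S′ rank′ rank) (rank-mono-⊆ S′-unique S′⊆S rank rank′)

-- The simplex on v₀ ∷ F is the cone with apex v₀ over the simplex on F; its faces
-- with m vertices are the faces of F with m vertices and the cones v₀ ∷ τ over the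
-- faces τ ∈ coneBase m of F with m - 1 vertices.
module Simplex {c ℓ} (K : Field c ℓ) (v₀ : ℕ) (F : Face) (F-face : IsFace (v₀ ∷ F)) where

  open Field K hiding (zero)
  open Homology K
  open LinearAlgebra K
  open Incidence K
  open import Algebra.Properties.Ring ring using (-0#≈0#)
  open import Relation.Binary.Reasoning.Setoid setoid

  base : ℕ → List Face
  base m = faces m ⟨ F ∷ [] ⟩

  coneBase : ℕ → List Face
  coneBase zero    = []
  coneBase (suc m) = base m

  ∈-base⁻ : ∀ {m τ} → τ ∈ base m → τ ⊑ F × length τ ≡ m
  ∈-base⁻ {m} τ∈ with ∈-faces⁻ m ⟨ F ∷ [] ⟩ τ∈
  ... | τ∈⟨F⟩ , |τ|≡m = ∈-⟨[ F ]⟩⁻ τ∈⟨F⟩ , |τ|≡m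

  ∈-base⁺ : ∀ {m τ} → τ ⊑ F → length τ ≡ m → τ ∈ base m
  ∈-base⁺ {m} τ⊑F = ∈-faces⁺ m ⟨ F ∷ [] ⟩ (∈-⟨[ F ]⟩⁺ τ⊑F)

  base-unique : ∀ m → Unique (base m)
  base-unique m = faces-unique m ⟨ F ∷ [] ⟩ (⟨⟩-unique (F ∷ []))

  ∈-coneBase⁻ : ∀ {m τ} → τ ∈ coneBase m → τ ⊑ F × suc (length τ) ≡ m
  ∈-coneBase⁻ {suc m} τ∈ with ∈-base⁻ τ∈
  ... | τ⊑F , |τ|≡m = τ⊑F , ≡.cong suc |τ|≡m

  ∈-coneBase⁺ : ∀ {m τ} → τ ⊑ F → suc (length τ) ≡ m → τ ∈ coneBase m
  ∈-coneBase⁺ τ⊑F ≡.refl = ∈-base⁺ τ⊑F ≡.refl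

  coneBase-unique : ∀ m → Unique (coneBase m)
  coneBase-unique zero    = []
  coneBase-unique (suc m) = base-unique m

  coneRows : ∀ m → Fin (length (coneBase m)) → Face → Carrier
  coneRows m k = coef (v₀ ∷ lookup (coneBase m) k)

  coef-apex : ∀ τ {ρ} → ρ ⊑ F → coef (v₀ ∷ τ) ρ ≈ δF ρ τ
  coef-apex τ {ρ} ρ⊑F = begin
    coef (v₀ ∷ τ) ρ                   ≈⟨ coef-cone v₀ τ ρ ⟩
    δF ρ τ - cone v₀ (coef τ) ρ  ≈⟨ +-congˡ (-‿cong (cone-outside v₀ (coef τ) ρ (IsFace⇒head∉ F-face ρ⊑F))) ⟩
    δF ρ τ - 0#                       ≈⟨ trans (+-congˡ -0#≈0#) (+-identityʳ _) ⟩
    δF ρ τ                            ∎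

  coneRows-independent : ∀ m → Independent (coneRows m)
  coneRows-independent m a rel k = begin
    a k
      ≈⟨ *-identityʳ (a k) ⟨
    a k * 1#
      ≈⟨ *-congˡ (δF-refl τₖ) ⟨
    a k * δF τₖ τₖ
      ≈⟨ sum-single k (λ l l≢k → trans (*-congˡ (δF-≢ (l≢k ∘ τ-injective ∘ ≡.sym))) (zeroʳ (a l))) ⟨
    a · (λ l → δF τₖ (τ l))
      ≈⟨ ·-congʳ a (λ l → coef-apex (τ l) (proj₁ (∈-coneBase⁻ {m} (∈-lookup k)))) ⟨
    a · (λ l → coneRows m l τₖ)
      ≈⟨ rel τₖ ⟩
    0#
      ∎
    where
    τ = lookup (coneBase m)
    τₖ = τ k
    τ-injective = Unique⇒lookup-injective (coneBase-unique m)

  simplex-inSpan : ∀ m {σ} → σ ⊑ v₀ ∷ F → length σ ≡ m → InSpan (coneRows m) (coef σ)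
  simplex-inSpan m {v₀ ∷ τ} (≡.refl ∷ τ⊑F) |σ|≡m =
    ≡.subst (λ τ → InSpan (coneRows m) (coef (v₀ ∷ τ))) (≡.sym (lookup-index τ∈)) (inSpan-member (coneRows m) (index τ∈))
    where
    τ∈ = ∈-coneBase⁺ τ⊑F |σ|≡m
  simplex-inSpan zero    {[]}    (_ ∷ʳ _)    _       = (λ ()) , λ ρ → refl
  simplex-inSpan (suc m) {σ}     (_ ∷ʳ σ⊑F) |σ|≡1+m = (λ k → coef σ (lookup (base m) k)) , λ ρ → begin
    coef σ ρ
      ≈⟨ ∂[v∗∂σ]≈∂σ v₀ σ ρ (∂∂≈0 σ) ⟨
    signedSum (bd σ) (λ ω → coef (v₀ ∷ ω) ρ)
      ≈⟨ signedSum-as-· (base m) (base-unique m) (bd σ) bd⊆base (λ ω → coef (v₀ ∷ ω) ρ) ⟩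
    (λ k → signedSum (bd σ) (δF (lookup (base m) k))) · (λ k → coneRows (suc m) k ρ)
      ≈⟨ ·-congˡ (λ k → coneRows (suc m) k ρ) (λ k → sym (coef≈signedSum σ (lookup (base m) k))) ⟩
    (λ k → coef σ (lookup (base m) k)) · (λ k → coneRows (suc m) k ρ)
      ∎
    where
    bd⊆base : ∀ {i ω} → (i , ω) ∈ bd σ → ω ∈ base m
    bd⊆base iω∈ with ∈-bd⁻ σ iω∈
    ... | ω⊑σ , |ω|+1≡|σ| = ∈-base⁺ (⊆-trans ω⊑σ σ⊑F) (ℕ.suc-injective (≡.trans |ω|+1≡|σ| |σ|≡1+m))

  simplex-rank : ∀ m (X : List Face) {r} → (∀ {σ} → σ ∈ X → σ ⊑ v₀ ∷ F × length σ ≡ m) →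
    (∀ {τ} → τ ∈ coneBase m → (v₀ ∷ τ) ∈ X) → Rank (rows X) r → r ≡ length (coneBase m)
  simplex-rank m X X⊆simplex cone⊆X rank@((s , _ , ind) , _) = ℕ.≤-antisym upper lower
    where
    upper = independent-inSpan⇒≤ (coneRows m) ind λ i ¬∈span →
      ¬∈span (simplex-inSpan m (proj₁ (X⊆simplex (∈-lookup (s i)))) (proj₂ (X⊆simplex (∈-lookup (s i)))))
    t : Fin (length (coneBase m)) → Fin (length X)
    t k = index (cone⊆X (∈-lookup k))
    X[t]≡ : ∀ k → v₀ ∷ lookup (coneBase m) k ≡ lookup X (t k)
    X[t]≡ k = lookup-index (cone⊆X (∈-lookup k))
    t-injective : Injective _≡_ _≡_ t
    t-injective {k} {l} tₖ≡tₗ = Unique⇒lookup-injective (coneBase-unique m)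
      (proj₂ (∷-injective (≡.trans (X[t]≡ k) (≡.trans (≡.cong (lookup X) tₖ≡tₗ) (≡.sym (X[t]≡ l))))))
    lower = independent⇒≤rank {u = rows X} t-injective
      (Independent-cong (λ k ρ → reflexive (≡.cong (λ σ → coef σ ρ) (X[t]≡ k))) (coneRows-independent m)) rank

  simplex-faces : ∀ m → length (faces m ⟨ (v₀ ∷ F) ∷ [] ⟩) ≡ length (coneBase (suc m)) ℕ.+ length (coneBase m)
  simplex-faces m =
    ≡.trans (length-cong-⊆⊇ (faces-unique m ⟨ (v₀ ∷ F) ∷ [] ⟩ (⟨⟩-unique ((v₀ ∷ F) ∷ []))) split-unique to from)
    (≡.trans (length-++ (base m)) (≡.cong (length (base m) ℕ.+_) (length-map (v₀ ∷_) (coneBase m))))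
    where
    split-unique : Unique (base m ++ map (v₀ ∷_) (coneBase m))
    split-unique = Unique.++⁺ (base-unique m) (Unique.map⁺ (proj₂ ∘ ∷-injective) (coneBase-unique m)) disjoint
      where
      disjoint : ∀ {σ} → ¬ (σ ∈ base m × σ ∈ map (v₀ ∷_) (coneBase m))
      disjoint (σ∈base , σ∈cone) with ∈-map⁻ (v₀ ∷_) σ∈cone
      ... | τ , _ , σ≡v₀∷τ = IsFace⇒head∉ F-face (proj₁ (∈-base⁻ σ∈base)) τ σ≡v₀∷τ
    to : ∀ {σ} → σ ∈ faces m ⟨ (v₀ ∷ F) ∷ [] ⟩ → σ ∈ base m ++ map (v₀ ∷_) (coneBase m)
    to σ∈ with ∈-faces⁻ m _ σ∈
    ... | σ∈⟨F⟩ , |σ|≡m with ∈-⟨[ v₀ ∷ F ]⟩⁻ σ∈⟨F⟩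
    ...   | _ ∷ʳ σ⊑F       = ∈-++⁺ˡ (∈-base⁺ σ⊑F |σ|≡m)
    ...   | ≡.refl ∷ τ⊑F   = ∈-++⁺ʳ (base m) (∈-map⁺ (v₀ ∷_) (∈-coneBase⁺ τ⊑F |σ|≡m))
    from : ∀ {σ} → σ ∈ base m ++ map (v₀ ∷_) (coneBase m) → σ ∈ faces m ⟨ (v₀ ∷ F) ∷ [] ⟩
    from σ∈ with ∈-++⁻ (base m) σ∈
    ... | inj₁ σ∈base with ∈-base⁻ σ∈base
    ...   | σ⊑F , |σ|≡m = ∈-faces⁺ m _ (∈-⟨[ v₀ ∷ F ]⟩⁺ (v₀ ∷ʳ σ⊑F)) |σ|≡m
    from σ∈ | inj₂ σ∈cone with ∈-map⁻ (v₀ ∷_) σ∈cone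
    ... | τ , τ∈ , ≡.refl with ∈-coneBase⁻ τ∈
    ...   | τ⊑F , |σ|≡m = ∈-faces⁺ m _ (∈-⟨[ v₀ ∷ F ]⟩⁺ (≡.refl ∷ τ⊑F)) |σ|≡m

  coneBase-top : length (coneBase (suc (length F))) ≡ 1
  coneBase-top = length-cong-⊆⊇ (base-unique (length F)) (All.[] ∷ []) to from
    where
    to : ∀ {τ} → τ ∈ base (length F) → τ ∈ F ∷ []
    to τ∈ with ∈-base⁻ τ∈
    ... | τ⊑F , |τ|≡|F| = here (⊑-length τ⊑F |τ|≡|F|)
    from : ∀ {τ} → τ ∈ F ∷ [] → τ ∈ base (length F)
    from (here ≡.refl) = ∈-base⁺ ⊆-refl ≡.refl

𝟙[_≡_] : ℕ → ℕ → ℕ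
𝟙[ m ≡ n ] with m ℕ.≟ n
... | yes _ = 1
... | no  _ = 0

𝟙-≢ : ∀ {m n} → m ≢ n → 𝟙[ m ≡ n ] ≡ 0
𝟙-≢ {m} {n} m≢n with m ℕ.≟ n
... | yes m≡n = contradiction m≡n m≢n
... | no  _   = ≡.refl

betti-cancel : ∀ {b r r′ f e} → b ℕ.+ r ℕ.+ r′ ≡ f → f ≡ e ℕ.+ r ℕ.+ r′ → b ≡ e
betti-cancel {b} {r} {r′} {e = e} b+r+r′≡f f≡e+r+r′ =
  ℕ.+-cancelʳ-≡ r b e (ℕ.+-cancelʳ-≡ r′ (b ℕ.+ r) (e ℕ.+ r) (≡.trans b+r+r′≡f f≡e+r+r′))

module EssentialFacet {c ℓ} (K : Field c ℓ) {L : List Face} (facets : IsFacetList L) {d v₀ : ℕ} {F′ : Face}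
  (F-essential : Homology.Essential K L d (v₀ ∷ F′)) where

  open Field K using (Carrier; _≈_; _*_; 0#; setoid; sym; trans; reflexive; *-comm; *-congˡ; zeroʳ)
  open Homology K
  open LinearAlgebra K
  open Incidence K
  open import Data.Nat using (_+_)

  F : Face
  F = v₀ ∷ F′

  n : ℕ
  n = suc d

  Δ Δ₁ Δ₂ Δ₁₂ : Complex
  Δ   = ⟨ L ⟩
  Δ₁  = ⟨ otherFacets F L ⟩
  Δ₂  = ⟨ F ∷ [] ⟩
  Δ₁₂ = Δ₁ ∩ Δ₂

  S S₁ : List Face
  S  = faces n Δ
  S₁ = faces n Δ₁

  F∈L : F ∈ L
  F∈L = proj₁ F-essential

  |F|≡n : length F ≡ n
  |F|≡n = proj₁ (proj₂ F-essential)

  i₀ : Fin (length S)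
  i₀ = proj₁ (proj₂ (proj₂ F-essential))

  S[i₀]≡F : lookup S i₀ ≡ F
  S[i₀]≡F = proj₁ (proj₂ (proj₂ (proj₂ F-essential)))

  z : Fin (length S) → Carrier
  z = proj₁ (proj₂ (proj₂ (proj₂ (proj₂ F-essential))))

  z-cycle-columns : ∀ t → sumF (λ s → z s * ∂ Δ n s t) ≈ 0#
  z-cycle-columns = proj₁ (proj₂ (proj₂ (proj₂ (proj₂ (proj₂ F-essential)))))

  z₀≉0 : ¬ (z i₀ ≈ 0#)
  z₀≉0 = proj₂ (proj₂ (proj₂ (proj₂ (proj₂ (proj₂ F-essential)))))

  F-face : IsFace F
  F-face = All.lookup (proj₁ facets) F∈L

  Δ-closed : Closed Δ
  Δ-closed = ⟨⟩-closed L

  Δ₁-closed : Closed Δ₁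
  Δ₁-closed = ⟨⟩-closed (otherFacets F L)

  Δ₂-closed : Closed Δ₂
  Δ₂-closed = ⟨⟩-closed (F ∷ [])

  faces-unique-⟨⟩ : ∀ j G → Unique (faces j ⟨ G ⟩)
  faces-unique-⟨⟩ j G = faces-unique j ⟨ G ⟩ (⟨⟩-unique G)

  S-injective : Injective _≡_ _≡_ (lookup S)
  S-injective = Unique⇒lookup-injective (faces-unique-⟨⟩ n L)

  ∈-others⁻ : ∀ {G} → G ∈ otherFacets F L → G ∈ L × G ≢ F
  ∈-others⁻ = ∈-filter⁻ (λ G → ¬? (G ≟F F))

  ∈-others⁺ : ∀ {G} → G ∈ L → G ≢ F → G ∈ otherFacets F L
  ∈-others⁺ = ∈-filter⁺ (λ G → ¬? (G ≟F F))

  F⊈other : ∀ {G} → G ∈ L → G ≢ F → ¬ (F ⊆ G)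
  F⊈other G∈L G≢F with AllPairs-lookup (proj₂ facets) F∈L G∈L (G≢F ∘ ≡.sym)
  ... | inj₁ (F⊈G , _) = F⊈G
  ... | inj₂ (_ , F⊈G) = F⊈G

  F∉Δ₁ : F ∉ Δ₁
  F∉Δ₁ F∈Δ₁ with ∈-⟨⟩⁻ (otherFacets F L) F∈Δ₁
  ... | G , G∈others , F⊑G = F⊈other (proj₁ (∈-others⁻ G∈others)) (proj₂ (∈-others⁻ G∈others)) (⊑⇒⊆ F⊑G)

  Δ₁⊆Δ : Δ₁ ⊆ Δ
  Δ₁⊆Δ σ∈Δ₁ with ∈-⟨⟩⁻ (otherFacets F L) σ∈Δ₁
  ... | G , G∈others , σ⊑G = ∈-⟨⟩⁺ L (proj₁ (∈-others⁻ G∈others)) σ⊑G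

  ∈Δ⇒∈Δ₁⊎⊑F : ∀ {σ} → σ ∈ Δ → σ ∈ Δ₁ ⊎ σ ⊑ F
  ∈Δ⇒∈Δ₁⊎⊑F σ∈Δ with ∈-⟨⟩⁻ L σ∈Δ
  ... | G , G∈L , σ⊑G with G ≟F F
  ...   | yes ≡.refl = inj₂ σ⊑G
  ...   | no  G≢F    = inj₁ (∈-⟨⟩⁺ (otherFacets F L) (∈-others⁺ G∈L G≢F) σ⊑G)

  ⊑F⇒≡F : ∀ {σ} → σ ⊑ F → length σ ≡ n → σ ≡ F
  ⊑F⇒≡F σ⊑F |σ|≡n = ⊑-length σ⊑F (≡.trans |σ|≡n (≡.sym |F|≡n))

  z-cycle : ∀ ρ → combination z (rows S) ρ ≈ 0#
  z-cycle = supported-vanishing col col? (supported-combination col col? z (rows-supported n Δ-closed))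
    (λ t → trans (reflexive (≡.sym (sumF≡sum (λ s → z s * ∂ Δ n s t)))) (z-cycle-columns t))
    where
    col = lookup (lowerFaces Δ n)
    col? = column? (lowerFaces Δ n)

  -- Only F can contain a boundary face of F lying outside Δ₁, so the cycle z
  -- would have coefficient 0 at F.
  bd-F⊆Δ₁ : ∀ {i ω} → (i , ω) ∈ bd F → ω ∈ Δ₁
  bd-F⊆Δ₁ {i} {ω} iω∈bd with ω ∈? Δ₁
  ... | yes ω∈Δ₁ = ω∈Δ₁
  ... | no  ω∉Δ₁ = contradiction z₀≈0 z₀≉0
    where
    coef-S[s]≈0 : ∀ s → s ≢ i₀ → coef (lookup S s) ω ≈ 0#
    coef-S[s]≈0 s s≢i₀ = coef-∉bd (lookup S s) ω∉bd
      where
      ω∉bd : ∀ {j ω′} → (j , ω′) ∈ bd (lookup S s) → ω′ ≢ ω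
      ω∉bd jω′∈bd ≡.refl with ∈-faces⁻ n Δ (∈-lookup s)
      ... | σ∈Δ , |σ|≡n with ∈Δ⇒∈Δ₁⊎⊑F σ∈Δ
      ...   | inj₁ σ∈Δ₁ = ω∉Δ₁ (Δ₁-closed σ∈Δ₁ (proj₁ (∈-bd⁻ (lookup S s) jω′∈bd)))
      ...   | inj₂ σ⊑F  = s≢i₀ (S-injective (≡.trans (⊑F⇒≡F σ⊑F |σ|≡n) (≡.sym S[i₀]≡F)))
    open import Relation.Binary.Reasoning.Setoid setoid
    z₀≈0 : z i₀ ≈ 0#
    z₀≈0 = nonzero-cancel (sgn-nonzero i) (begin
      sgn i * z i₀
        ≈⟨ *-comm (sgn i) (z i₀) ⟩
      z i₀ * sgn i
        ≈⟨ *-congˡ (coef-∈bd F F-face iω∈bd) ⟨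
      z i₀ * coef F ω
        ≡⟨ ≡.cong (λ σ → z i₀ * coef σ ω) S[i₀]≡F ⟨
      z i₀ * coef (lookup S i₀) ω
        ≈⟨ sum-single i₀ (λ s s≢i₀ → trans (*-congˡ (coef-S[s]≈0 s s≢i₀)) (zeroʳ (z s))) ⟨
      combination z (rows S) ω
        ≈⟨ z-cycle ω ⟩
      0#
        ∎)

  ⊏F⇒∈Δ₁ : ∀ {σ} → σ ⊑ F → σ ≢ F → σ ∈ Δ₁
  ⊏F⇒∈Δ₁ σ⊑F σ≢F with ⊏⇒⊑bd F σ⊑F σ≢F
  ... | _ , _ , iω∈bd , σ⊑ω = Δ₁-closed (bd-F⊆Δ₁ iω∈bd) σ⊑ω

  ∈Δ⇒∈Δ₁⊎≡F : ∀ {σ} → σ ∈ Δ → σ ∈ Δ₁ ⊎ σ ≡ F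
  ∈Δ⇒∈Δ₁⊎≡F {σ} σ∈Δ with ∈Δ⇒∈Δ₁⊎⊑F σ∈Δ
  ... | inj₁ σ∈Δ₁ = inj₁ σ∈Δ₁
  ... | inj₂ σ⊑F with σ ≟F F
  ...   | yes σ≡F = inj₂ σ≡F
  ...   | no  σ≢F = inj₁ (⊏F⇒∈Δ₁ σ⊑F σ≢F)

  ∈Δ₁₂⁻ : ∀ {σ} → σ ∈ Δ₁₂ → σ ⊑ F × σ ≢ F
  ∈Δ₁₂⁻ σ∈Δ₁₂ with ∈-∩⁻ Δ₁ Δ₂ σ∈Δ₁₂
  ... | σ∈Δ₁ , σ∈Δ₂ = ∈-⟨[ F ]⟩⁻ σ∈Δ₂ , λ { ≡.refl → F∉Δ₁ σ∈Δ₁ }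

  ∈Δ₁₂⁺ : ∀ {σ} → σ ⊑ F → σ ≢ F → σ ∈ Δ₁₂
  ∈Δ₁₂⁺ σ⊑F σ≢F = ∈-∩⁺ Δ₁ Δ₂ (⊏F⇒∈Δ₁ σ⊑F σ≢F) (∈-⟨[ F ]⟩⁺ σ⊑F)

  faces-Δ₁⊆Δ : ∀ j → faces j Δ₁ ⊆ faces j Δ
  faces-Δ₁⊆Δ j σ∈ with ∈-faces⁻ j Δ₁ σ∈
  ... | σ∈Δ₁ , |σ|≡j = ∈-faces⁺ j Δ (Δ₁⊆Δ σ∈Δ₁) |σ|≡j

  faces-Δ⊆Δ₁ : ∀ {j σ} → σ ∈ faces j Δ → σ ≢ F → σ ∈ faces j Δ₁
  faces-Δ⊆Δ₁ {j} σ∈ σ≢F with ∈-faces⁻ j Δ σ∈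
  ... | σ∈Δ , |σ|≡j with ∈Δ⇒∈Δ₁⊎≡F σ∈Δ
  ...   | inj₁ σ∈Δ₁ = ∈-faces⁺ j Δ₁ σ∈Δ₁ |σ|≡j
  ...   | inj₂ σ≡F  = contradiction σ≡F σ≢F

  ≢n⇒≢F : ∀ {j σ} → j ≢ n → length σ ≡ j → σ ≢ F
  ≢n⇒≢F j≢n |σ|≡j ≡.refl = j≢n (≡.trans (≡.sym |σ|≡j) |F|≡n)

  faces-Δ : ∀ j → length (faces j Δ) ≡ 𝟙[ j ≡ n ] + length (faces j Δ₁)
  faces-Δ j with j ℕ.≟ n
  ... | no j≢n = length-cong-⊆⊇ (faces-unique-⟨⟩ j L) (faces-unique-⟨⟩ j (otherFacets F L))
                   (λ σ∈ → faces-Δ⊆Δ₁ σ∈ (≢n⇒≢F j≢n (proj₂ (∈-faces⁻ j Δ σ∈)))) (faces-Δ₁⊆Δ j)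
  ... | yes ≡.refl = length-cong-⊆⊇ (faces-unique-⟨⟩ n L) (F∉S₁ ∷ faces-unique-⟨⟩ n (otherFacets F L)) to from
    where
    F∉S₁ : All.All (F ≢_) S₁
    F∉S₁ = All.tabulate λ σ∈S₁ F≡σ → F∉Δ₁ (≡.subst (_∈ Δ₁) (≡.sym F≡σ) (proj₁ (∈-faces⁻ n Δ₁ σ∈S₁)))
    to : faces n Δ ⊆ F ∷ S₁
    to {σ} σ∈ with σ ≟F F
    ... | yes σ≡F = here σ≡F
    ... | no  σ≢F = there (faces-Δ⊆Δ₁ σ∈ σ≢F)
    from : F ∷ S₁ ⊆ faces n Δ
    from (here ≡.refl) = ∈-faces⁺ n Δ (∈-⟨⟩⁺ L F∈L ⊆-refl) |F|≡n
    from (there σ∈S₁) = faces-Δ₁⊆Δ n σ∈S₁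

  row-F∈span : InSpan (rows S₁) (coef F)
  row-F∈span = ≡.subst (InSpan (rows S₁) ∘ coef) S[i₀]≡F
    (relation⇒inSpan {u = rows S} z i₀ z-cycle z₀≉0 λ i i≢i₀ →
      inSpan-rows S₁ (faces-Δ⊆Δ₁ (∈-lookup i) (S[i]≢F i≢i₀)))
    where
    S[i]≢F : ∀ {i} → i ≢ i₀ → lookup S i ≢ F
    S[i]≢F i≢i₀ S[i]≡F = i≢i₀ (S-injective (≡.trans S[i]≡F (≡.sym S[i₀]≡F)))

  rank-Δ : ∀ j {r r₁} → HasRank (∂ Δ j) r → HasRank (∂ Δ₁ j) r₁ → r ≡ r₁
  rank-Δ j ρ ρ₁ with j ℕ.≟ n
  ... | no j≢n = rank-cong-⊆⊇ (faces-unique-⟨⟩ j L) (faces-unique-⟨⟩ j (otherFacets F L))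
                   (λ σ∈ → faces-Δ⊆Δ₁ σ∈ (≢n⇒≢F j≢n (proj₂ (∈-faces⁻ j Δ σ∈)))) (faces-Δ₁⊆Δ j)
                   (hasRank⇒rank-rows Δ-closed ρ) (hasRank⇒rank-rows Δ₁-closed ρ₁)
  ... | yes ≡.refl = ℕ.≤-antisym
          (rank-mono col col? (rows-supported n Δ₁-closed) rows-S∈span
             (hasRank⇒rank-rows Δ₁-closed ρ₁) (hasRank⇒rank-rows Δ-closed ρ))
          (rank-mono-⊆ (faces-unique-⟨⟩ n (otherFacets F L)) (faces-Δ₁⊆Δ n)
             (hasRank⇒rank-rows Δ-closed ρ) (hasRank⇒rank-rows Δ₁-closed ρ₁))
    where
    col = lookup (lowerFaces Δ₁ n)
    col? = column? (lowerFaces Δ₁ n)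
    rows-S∈span : ∀ i → InSpan (rows S₁) (rows S i)
    rows-S∈span i with lookup S i ≟F F
    ... | yes S[i]≡F = ≡.subst (InSpan (rows S₁) ∘ coef) (≡.sym S[i]≡F) row-F∈span
    ... | no  S[i]≢F = inSpan-rows S₁ (faces-Δ⊆Δ₁ (∈-lookup i) S[i]≢F)

  open Simplex K v₀ F′ F-face using (coneBase; ∈-coneBase⁻; simplex-rank; simplex-faces; coneBase-top)

  |F′|≡d : length F′ ≡ d
  |F′|≡d = ℕ.suc-injective |F|≡n

  cone∈faces-Δ₂ : ∀ j {τ} → τ ∈ coneBase j → (v₀ ∷ τ) ∈ faces j Δ₂
  cone∈faces-Δ₂ j τ∈ with ∈-coneBase⁻ {j} τ∈
  ... | τ⊑F′ , |v₀∷τ|≡j = ∈-faces⁺ j Δ₂ (∈-⟨[ F ]⟩⁺ (≡.refl ∷ τ⊑F′)) |v₀∷τ|≡j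

  rank-Δ₂ : ∀ j {r} → HasRank (∂ Δ₂ j) r → r ≡ length (coneBase j)
  rank-Δ₂ j ρ = simplex-rank j (faces j Δ₂)
    (λ σ∈ → ∈-⟨[ F ]⟩⁻ (proj₁ (∈-faces⁻ j Δ₂ σ∈)) , proj₂ (∈-faces⁻ j Δ₂ σ∈))
    (cone∈faces-Δ₂ j)
    (hasRank⇒rank-rows Δ₂-closed ρ)

  faces-Δ₁₂⊆Δ₂ : ∀ j → faces j Δ₁₂ ⊆ faces j Δ₂
  faces-Δ₁₂⊆Δ₂ j σ∈ with ∈-faces⁻ j Δ₁₂ σ∈
  ... | σ∈Δ₁₂ , |σ|≡j = ∈-faces⁺ j Δ₂ (∈-⟨[ F ]⟩⁺ (proj₁ (∈Δ₁₂⁻ σ∈Δ₁₂))) |σ|≡j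

  faces-Δ₂⊆Δ₁₂ : ∀ {j} → j ≢ n → faces j Δ₂ ⊆ faces j Δ₁₂
  faces-Δ₂⊆Δ₁₂ {j} j≢n σ∈ with ∈-faces⁻ j Δ₂ σ∈
  ... | σ∈Δ₂ , |σ|≡j = ∈-faces⁺ j Δ₁₂ (∈Δ₁₂⁺ (∈-⟨[ F ]⟩⁻ σ∈Δ₂) (≢n⇒≢F j≢n |σ|≡j)) |σ|≡j

  faces-Δ₁₂-unique : ∀ j → Unique (faces j Δ₁₂)
  faces-Δ₁₂-unique j = faces-unique j Δ₁₂ (∩-unique Δ₁ Δ₂ (⟨⟩-unique (otherFacets F L)))

  faces-Δ₁₂ : ∀ {j} → j ≢ n → length (faces j Δ₁₂) ≡ length (faces j Δ₂)
  faces-Δ₁₂ {j} j≢n =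
    length-cong-⊆⊇ (faces-Δ₁₂-unique j) (faces-unique-⟨⟩ j (F ∷ [])) (faces-Δ₁₂⊆Δ₂ j) (faces-Δ₂⊆Δ₁₂ j≢n)

  faces-Δ₁₂-top : length (faces n Δ₁₂) ≡ 0
  faces-Δ₁₂-top = ℕ.n≤0⇒n≡0 (length-mono-⊆ (faces-Δ₁₂-unique n) ⊏F)
    where
    ⊏F : faces n Δ₁₂ ⊆ []
    ⊏F σ∈ with ∈-faces⁻ n Δ₁₂ σ∈
    ... | σ∈Δ₁₂ , |σ|≡n with ∈Δ₁₂⁻ σ∈Δ₁₂
    ...   | σ⊑F , σ≢F = contradiction (⊑F⇒≡F σ⊑F |σ|≡n) σ≢F

  Δ₁₂-closed : Closed Δ₁₂
  Δ₁₂-closed = ∩-closed Δ₁ Δ₂ Δ₁-closed Δ₂-closed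

  rank-Δ₁₂ : ∀ {j r} → j ≢ n → HasRank (∂ Δ₁₂ j) r → r ≡ length (coneBase j)
  rank-Δ₁₂ {j} j≢n ρ = simplex-rank j (faces j Δ₁₂)
    (λ σ∈ → ∈-⟨[ F ]⟩⁻ (proj₁ (∈-faces⁻ j Δ₂ (faces-Δ₁₂⊆Δ₂ j σ∈))) , proj₂ (∈-faces⁻ j Δ₁₂ σ∈))
    (faces-Δ₂⊆Δ₁₂ j≢n ∘ cone∈faces-Δ₂ j)
    (hasRank⇒rank-rows Δ₁₂-closed ρ)

  rank-Δ₁₂-top : ∀ {r} → HasRank (∂ Δ₁₂ n) r → r ≡ 0
  rank-Δ₁₂-top ((s , s-inj , _) , _) = ℕ.n≤0⇒n≡0 (≡.subst (_ ℕ.≤_) faces-Δ₁₂-top (Fin.injective⇒≤ s-inj))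

  betti-Δ : ∀ j {b b₁} → RBetti Δ j b → RBetti Δ₁ j b₁ → b ≡ 𝟙[ j ≡ n ] + b₁
  betti-Δ j {b₁ = b₁} (r , r′ , ρ , ρ′ , b+r+r′≡f) (r₁ , r₁′ , ρ₁ , ρ₁′ , b₁+r₁+r₁′≡f₁) =
    betti-cancel b+r+r′≡f (begin
    length (faces j Δ)
      ≡⟨ faces-Δ j ⟩
    𝟙[ j ≡ n ] + length (faces j Δ₁)
      ≡⟨ ≡.cong (𝟙[ j ≡ n ] +_) b₁+r₁+r₁′≡f₁ ⟨
    𝟙[ j ≡ n ] + (b₁ + r₁ + r₁′)
      ≡⟨ ≡.cong₂ (λ x y → 𝟙[ j ≡ n ] + (b₁ + x + y)) (rank-Δ j ρ ρ₁) (rank-Δ (suc j) ρ′ ρ₁′) ⟨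
    𝟙[ j ≡ n ] + (b₁ + r + r′)
      ≡⟨ ℕ.+-assoc 𝟙[ j ≡ n ] (b₁ + r) r′ ⟨
    𝟙[ j ≡ n ] + (b₁ + r) + r′
      ≡⟨ ≡.cong (_+ r′) (ℕ.+-assoc 𝟙[ j ≡ n ] b₁ r) ⟨
    𝟙[ j ≡ n ] + b₁ + r + r′
      ∎)
    where open ≡.≡-Reasoning

  betti-Δ₂ : ∀ j {b₂} → RBetti Δ₂ j b₂ → b₂ ≡ 0
  betti-Δ₂ j (r , r′ , ρ , ρ′ , b₂+r+r′≡f) = betti-cancel b₂+r+r′≡f (begin
    length (faces j Δ₂)                                       ≡⟨ simplex-faces j ⟩
    length (coneBase (suc j)) + length (coneBase j)           ≡⟨ ℕ.+-comm (length (coneBase (suc j))) _ ⟩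
    length (coneBase j) + length (coneBase (suc j))           ≡⟨ ≡.cong₂ _+_ (rank-Δ₂ j ρ) (rank-Δ₂ (suc j) ρ′) ⟨
    r + r′                                                    ∎)
    where open ≡.≡-Reasoning

  betti-Δ₁₂ : ∀ j {b₃} → RBetti Δ₁₂ j b₃ → b₃ ≡ 𝟙[ suc j ≡ n ]
  betti-Δ₁₂ j {b₃} (r , r′ , ρ , ρ′ , b₃+r+r′≡f) with j ℕ.≟ n
  ... | yes ≡.refl = ≡.trans (ℕ.m+n≡0⇒m≡0 b₃ (ℕ.m+n≡0⇒m≡0 (b₃ + r) (≡.trans b₃+r+r′≡f faces-Δ₁₂-top)))
                             (≡.sym (𝟙-≢ (ℕ.1+n≢n {n})))
  ... | no j≢n with suc j ℕ.≟ n
  ...   | yes 1+j≡n = betti-cancel b₃+r+r′≡f (begin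
          length (faces j Δ₁₂)
            ≡⟨ faces-Δ₁₂ j≢n ⟩
          length (faces j Δ₂)
            ≡⟨ simplex-faces j ⟩
          length (coneBase (suc j)) + length (coneBase j)
            ≡⟨ ≡.cong₂ _+_ top (≡.sym (rank-Δ₁₂ j≢n ρ)) ⟩
          1 + r
            ≡⟨ ℕ.+-identityʳ (1 + r) ⟨
          1 + r + 0
            ≡⟨ ≡.cong (1 + r +_) (rank-Δ₁₂-top (≡.subst (λ j′ → HasRank (∂ Δ₁₂ j′) r′) 1+j≡n ρ′)) ⟨
          1 + r + r′
            ∎)
    where
    open ≡.≡-Reasoning
    top : length (coneBase (suc j)) ≡ 1
    top = ≡.trans (≡.cong (length ∘ coneBase) (≡.trans 1+j≡n (≡.cong suc (≡.sym |F′|≡d)))) coneBase-top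
  ...   | no 1+j≢n = betti-cancel b₃+r+r′≡f (begin
          length (faces j Δ₁₂)                              ≡⟨ faces-Δ₁₂ j≢n ⟩
          length (faces j Δ₂)                               ≡⟨ simplex-faces j ⟩
          length (coneBase (suc j)) + length (coneBase j)   ≡⟨ ℕ.+-comm (length (coneBase (suc j))) _ ⟩
          length (coneBase j) + length (coneBase (suc j))   ≡⟨ ≡.cong₂ _+_ (rank-Δ₁₂ j≢n ρ) (rank-Δ₁₂ 1+j≢n ρ′) ⟨
          r + r′                                            ∎)
    where open ≡.≡-Reasoning

  splitting : HomologySplitting Δ Δ₁ Δ₂
  splitting = inj₂ λ k b b₁ b₂ b₃ β β₁ β₂ β₃ → begin
    b                      ≡⟨ betti-Δ (suc k) β β₁ ⟩
    𝟙[ suc k ≡ n ] + b₁    ≡⟨ ℕ.+-comm 𝟙[ suc k ≡ n ] b₁ ⟩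
    b₁ + 𝟙[ suc k ≡ n ]    ≡⟨ ≡.cong₂ _+_ (ℕ.+-identityʳ b₁) (betti-Δ₁₂ k β₃) ⟨
    b₁ + 0 + b₃            ≡⟨ ≡.cong (λ x → b₁ + x + b₃) (betti-Δ₂ (suc k) β₂) ⟨
    b₁ + b₂ + b₃           ∎
    where open ≡.≡-Reasoning

proposition4p5 : ∀ {c ℓ : Level} (K : Field c ℓ) (L : List Face) → IsFacetList L →
    (d : ℕ) (F : Face) → Homology.Essential K L d F →
    Homology.HomologySplitting K ⟨ L ⟩ ⟨ otherFacets F L ⟩ ⟨ F ∷ [] ⟩
proposition4p5 K L facets d []       (_ , () , _)
proposition4p5 K L facets d (v ∷ F) F-essential = EssentialFacet.splitting K facets F-essential
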